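{- Let $M$ be a $3$-connected matroid with no detachable pairs. Let $F = (e_1,e_2,\ldots,e_{|F|})$ be a maximal fan of $M$ with odd length at least five such that $\{e_1,e_2,e_3\}$ is a triangle. Then $|F| = 5$, and there exists $z \in E(M) - F$ such that $\{e_1,e_3,e_5,z\}$ is a cocircuit.
   Context: Triangle = 3-element circuit, triad = 3-element cocircuit. A fan is a set $F$ with $|F|=2$, or $|F|\ge3$ with an ordering $(e_1,\dots,e_{|F|})$ (a fan ordering; we write $F=(e_1,\dots,e_{|F|})$) such that $\{e_1,e_2,e_3\}$ is a triangle or a triad and, for each $i\le|F|-3$, if $\{e_i,e_{i+1},e_{i+2}\}$ is a triangle then $\{e_{i+1},e_{i+2},e_{i+3}\}$ is a triad and vice versa. Maximal = not properly contained in another fan; length $=|F|$. A pair $\{e,f\}$ is detachable if $M\backslash e\backslash f$ or $M/e/f$ is 3-connected. -}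

module Defs where

open import Data.Nat using (ℕ; _+_; _∸_; _≤_; _<_)
open import Data.Fin using (Fin)
open import Data.Fin.Subset using (Subset; ⊤; ⊥; ⁅_⁆; _∪_; _∩_; ∁; ∣_∣; _⊆_; _⊂_; _∈_; _∉_)
open import Data.List using (List; []; _∷_; foldr; length)
open import Data.List.Relation.Unary.Unique.Propositional using (Unique)
open import Data.Product using (_×_; ∃; ∃-syntax; Σ)
open import Data.Sum using (_⊎_)
open import Data.Unit using () renaming (⊤ to Unit)
open import Relation.Binary.PropositionalEquality using (_≡_; _≢_)
open import Relation.Nullary using (¬_)

data Odd : ℕ → Set where
  odd-one : Odd 1
  odd-ss  : ∀ {m} → Odd m → Odd (Data.Nat.suc (Data.Nat.suc m))

record Matroid (n : ℕ) : Set where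
  field
    rank   : Subset n → ℕ
    r-bound : ∀ X → rank X ≤ ∣ X ∣
    r-mono  : ∀ {X Y} → X ⊆ Y → rank X ≤ rank Y
    r-submod : ∀ X Y → rank (X ∪ Y) + rank (X ∩ Y) ≤ rank X + rank Y
open Matroid public

module _ {n : ℕ} where

  IsCircuitρ : (Subset n → ℕ) → Subset n → Set
  IsCircuitρ ρ C = (ρ C < ∣ C ∣) × (∀ D → D ⊂ C → ρ D ≡ ∣ D ∣)

  dualRank : Matroid n → Subset n → ℕ
  dualRank M X = ∣ X ∣ + rank M (∁ X) ∸ rank M ⊤

  IsCircuit : Matroid n → Subset n → Set
  IsCircuit M = IsCircuitρ (rank M)

  IsCocircuit : Matroid n → Subset n → Set
  IsCocircuit M = IsCircuitρ (dualRank M)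

  IsTriangle : Matroid n → Subset n → Set
  IsTriangle M X = IsCircuit M X × ∣ X ∣ ≡ 3

  IsTriad : Matroid n → Subset n → Set
  IsTriad M X = IsCocircuit M X × ∣ X ∣ ≡ 3

  -- The matroid on ground set S ⊆ E(M) with rank function ρ (defined on subsets of S)
  -- is 3-connected: it has no k-separation for k = 1, 2.  A k-separation is a
  -- partition (X, S − X) with |X|, |S − X| ≥ k and ρ X + ρ (S − X) − ρ S < k.
  ThreeConnectedOn : Subset n → (Subset n → ℕ) → Set
  ThreeConnectedOn S ρ =
    ∀ (k : ℕ) → 1 ≤ k → k < 3 → ∀ X → X ⊆ S →
      ¬ ((k ≤ ∣ X ∣) × (k ≤ ∣ S ∩ ∁ X ∣) × (ρ X + ρ (S ∩ ∁ X) < ρ S + k))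

  ThreeConnected : Matroid n → Set
  ThreeConnected M = ThreeConnectedOn ⊤ (rank M)

  -- M \ T : ground set E − T, rank r restricted.
  -- M / T : ground set E − T, rank X ↦ r(X ∪ T) − r(T).
  contractRank : Matroid n → Subset n → Subset n → ℕ
  contractRank M T X = rank M (X ∪ T) ∸ rank M T

  Detachable : Matroid n → Fin n → Fin n → Set
  Detachable M e f =
    ThreeConnectedOn (∁ (⁅ e ⁆ ∪ ⁅ f ⁆)) (rank M)
    ⊎ ThreeConnectedOn (∁ (⁅ e ⁆ ∪ ⁅ f ⁆)) (contractRank M (⁅ e ⁆ ∪ ⁅ f ⁆))

  NoDetachablePairs : Matroid n → Set
  NoDetachablePairs M = ∀ e f → e ≢ f → ¬ Detachable M e f

  toSet : List (Fin n) → Subset n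
  toSet = foldr (λ x S → ⁅ x ⁆ ∪ S) ⊥

  triple : Fin n → Fin n → Fin n → Subset n
  triple a b c = ⁅ a ⁆ ∪ (⁅ b ⁆ ∪ ⁅ c ⁆)

  Alternates : Matroid n → List (Fin n) → Set
  Alternates M (a ∷ b ∷ c ∷ d ∷ rest) =
    (IsTriangle M (triple a b c) → IsTriad M (triple b c d))
    × (IsTriad M (triple a b c) → IsTriangle M (triple b c d))
    × Alternates M (b ∷ c ∷ d ∷ rest)
  Alternates M _ = Unit

  IsFanOrdering : Matroid n → List (Fin n) → Set
  IsFanOrdering M (a ∷ b ∷ c ∷ rest) =
    Unique (a ∷ b ∷ c ∷ rest)
    × (IsTriangle M (triple a b c) ⊎ IsTriad M (triple a b c))
    × Alternates M (a ∷ b ∷ c ∷ rest)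
  IsFanOrdering M _ = Data.Empty.⊥
    where import Data.Empty

  IsFan : Matroid n → Subset n → Set
  IsFan M F = (∣ F ∣ ≡ 2) ⊎ (∃[ xs ] (IsFanOrdering M xs × toSet xs ≡ F))

  IsMaximalFan : Matroid n → Subset n → Set
  IsMaximalFan M F = IsFan M F × (∀ G → F ⊂ G → ¬ IsFan M G)

{-# OPTIONS --safe #-}
-- Write F = (e₀, …, e₂ₘ) with m ≥ 2: its triangles are {e₂ₜ, e₂ₜ₊₁, e₂ₜ₊₂} and its triads {e₂ₜ₊₁, e₂ₜ₊₂, e₂ₜ₊₃}.
-- As {e₀, e₂ₘ} is not detachable, M \ e₀ \ e₂ₘ has a 1- or 2-separation (A, B). An element of a triad whose
-- two partners avoid B is not spanned by the rest of B, so it can be moved from B to A. Doing this at the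
-- triads {e₁, e₂, e₃} and {e₂ₘ₋₃, e₂ₘ₋₂, e₂ₘ₋₁} puts e₁, e₂ on one side and e₂ₘ₋₂, e₂ₘ₋₁ on one side; then
-- e₀ and e₂ₘ, spanned by these pairs, can be added back, giving a 1- or 2-separation of M. So some move
-- fails, which happens only when the side it shrinks has at most two elements; then {e₀, e₂ₘ, eᵢ, y}
-- contains a cocircuit for i = 1 or 2 (or for the mirror images e₂ₘ₋₁, e₂ₘ₋₂). A rank count over the
-- triangles and triads shows that a subset of F containing a cocircuit contains the last two elements of
-- some triad; with orthogonality and the maximality of F this leaves only i = 2, m = 2 and y ∉ F, where
-- {e₀, e₂, e₄, y} is a cocircuit.
module Submission where

open import Defs
open import Data.Nat using (ℕ; zero; suc; _+_; _∸_; _≤_; _<_; _≤?_; _<?_; _≟_; z≤n; s≤s; z<s)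
open import Data.Nat.Properties
open import Data.Fin using (Fin)
open import Data.Fin.Properties using () renaming (_≟_ to _≟ᶠ_)
open import Data.Fin.Subset renaming (⊥ to ∅)
open import Data.Fin.Subset.Properties
open import Data.Vec.Base using ([]; _∷_; here; there)
open import Data.List using (List; []; _∷_; length; applyUpTo)
open import Data.List.Membership.Propositional using () renaming (_∈_ to _∈ₗ_; _∉_ to _∉ₗ_)
open import Data.List.Relation.Unary.Any using (here; there)
open import Data.List.Membership.Propositional.Properties using (∈-applyUpTo⁺; ∈-applyUpTo⁻)
open import Data.List.Relation.Unary.All as All using (All; []; _∷_)
import Data.List.Relation.Unary.All.Properties as Allₚ
open import Data.List.Relation.Unary.All.Properties using (All¬⇒¬Any)
open import Data.List.Relation.Unary.AllPairs using ([]; _∷_)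
open import Data.List.Relation.Unary.Unique.Propositional using (Unique)
import Data.List.Relation.Unary.Unique.Propositional.Properties as Uniqueₚ
open import Data.List.Relation.Binary.Subset.Propositional using () renaming (_⊆_ to _⊆ₗ_)
open import Data.List.Relation.Binary.Subset.Propositional.Properties using (⊆-reflexive-↭)
open import Data.List.Relation.Binary.Permutation.Propositional using (_↭_; ↭-sym) renaming (refl to ↭-refl; prep to ↭-prep; swap to ↭-swap; trans to ↭-trans)
open import Data.List.Relation.Binary.Permutation.Propositional.Properties using (shift)
open import Data.Product using (Σ; ∃; ∃-syntax; _×_; _,_; proj₁; proj₂)
import Data.Product
open import Data.Sum using (_⊎_; inj₁; inj₂)
import Data.Sum
open import Data.Empty using (⊥; ⊥-elim)
open import Data.Unit using (tt)
open import Relation.Nullary using (¬_; Dec; yes; no; contradiction)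
open import Relation.Nullary.Decidable using (_×-dec_; True; False; toWitness; toWitnessFalse)
open import Function using (_∘_; case_of_)
open import Relation.Binary.PropositionalEquality using (_≡_; _≢_; refl; sym; trans; cong; cong₂; subst; ≢-sym; module ≡-Reasoning)

private
  variable
    n : ℕ

∣p∪q∣≤∣p∣+∣q∣ : (p q : Subset n) → ∣ p ∪ q ∣ ≤ ∣ p ∣ + ∣ q ∣
∣p∪q∣≤∣p∣+∣q∣ []            []            = z≤n
∣p∪q∣≤∣p∣+∣q∣ (inside ∷ p)  (inside ∷ q)  = s≤s (≤-trans (∣p∪q∣≤∣p∣+∣q∣ p q) (+-monoʳ-≤ ∣ p ∣ (n≤1+n ∣ q ∣)))
∣p∪q∣≤∣p∣+∣q∣ (inside ∷ p)  (outside ∷ q) = s≤s (∣p∪q∣≤∣p∣+∣q∣ p q)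
∣p∪q∣≤∣p∣+∣q∣ (outside ∷ p) (inside ∷ q)  = subst (suc ∣ p ∪ q ∣ ≤_) (sym (+-suc ∣ p ∣ ∣ q ∣)) (s≤s (∣p∪q∣≤∣p∣+∣q∣ p q))
∣p∪q∣≤∣p∣+∣q∣ (outside ∷ p) (outside ∷ q) = ∣p∪q∣≤∣p∣+∣q∣ p q

x∈p─q⇒x∉q : ∀ (p q : Subset n) {x} → x ∈ p ─ q → x ∉ q
x∈p─q⇒x∉q (_ ∷ p) (outside ∷ q) here ()
x∈p─q⇒x∉q (_ ∷ p) (_ ∷ q) (there x∈p─q) (there x∈q) = x∈p─q⇒x∉q p q x∈p─q x∈q

x∈p-y⇒x∈p : ∀ {p : Subset n} {x y} → x ∈ p - y → x ∈ p
x∈p-y⇒x∈p {p = p} {y = y} = p─q⊆p p ⁅ y ⁆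

x∈p-y⇒x≢y : ∀ {p : Subset n} {x y} → x ∈ p - y → x ≢ y
x∈p-y⇒x≢y {p = p} {y = y} x∈p-y refl = x∈p─q⇒x∉q p ⁅ y ⁆ x∈p-y (x∈⁅x⁆ y)

∣p∣≤suc∣p-x∣ : ∀ (p : Subset n) x → ∣ p ∣ ≤ suc ∣ p - x ∣
∣p∣≤suc∣p-x∣ p x = begin
  ∣ p ∣                 ≤⟨ p⊆q⇒∣p∣≤∣q∣ p⊆[p-x]∪x ⟩
  ∣ (p - x) ∪ ⁅ x ⁆ ∣   ≤⟨ ∣p∪q∣≤∣p∣+∣q∣ (p - x) ⁅ x ⁆ ⟩
  ∣ p - x ∣ + ∣ ⁅ x ⁆ ∣ ≡⟨ cong (∣ p - x ∣ +_) (∣⁅x⁆∣≡1 x) ⟩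
  ∣ p - x ∣ + 1         ≡⟨ +-comm ∣ p - x ∣ 1 ⟩
  suc ∣ p - x ∣         ∎
  where
  open ≤-Reasoning
  p⊆[p-x]∪x : p ⊆ (p - x) ∪ ⁅ x ⁆
  p⊆[p-x]∪x {y} y∈p with y ≟ᶠ x
  ... | yes refl = q⊆p∪q (p - x) ⁅ x ⁆ (x∈⁅x⁆ x)
  ... | no y≢x   = p⊆p∪q ⁅ x ⁆ (x∈p∧x≢y⇒x∈p-y y∈p y≢x)

∈-toSet⁺ : ∀ {x : Fin n} {xs} → x ∈ₗ xs → x ∈ toSet xs
∈-toSet⁺ {xs = y ∷ xs} (here refl)  = p⊆p∪q (toSet xs) (x∈⁅x⁆ y)
∈-toSet⁺ {xs = y ∷ xs} (there x∈xs) = q⊆p∪q ⁅ y ⁆ (toSet xs) (∈-toSet⁺ x∈xs)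

∈-toSet⁻ : ∀ {x : Fin n} xs → x ∈ toSet xs → x ∈ₗ xs
∈-toSet⁻ []       x∈∅ = contradiction x∈∅ ∉⊥
∈-toSet⁻ (y ∷ xs) x∈  with x∈p∪q⁻ ⁅ y ⁆ (toSet xs) x∈
... | inj₁ x∈⁅y⁆ = here (x∈⁅y⁆⇒x≡y y x∈⁅y⁆)
... | inj₂ x∈xs  = there (∈-toSet⁻ xs x∈xs)

toSet-mono : ∀ {xs ys : List (Fin n)} → xs ⊆ₗ ys → toSet xs ⊆ toSet ys
toSet-mono {xs = xs} xs⊆ys x∈ = ∈-toSet⁺ (xs⊆ys (∈-toSet⁻ xs x∈))

toSet-↭ : ∀ {xs ys : List (Fin n)} → xs ↭ ys → toSet xs ≡ toSet ys
toSet-↭ xs↭ys = ⊆-antisym (toSet-mono (⊆-reflexive-↭ xs↭ys)) (toSet-mono (⊆-reflexive-↭ (↭-sym xs↭ys)))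

∣toSet∣≤length : ∀ (xs : List (Fin n)) → ∣ toSet xs ∣ ≤ length xs
∣toSet∣≤length {n} []       = ≤-reflexive (∣⊥∣≡0 n)
∣toSet∣≤length     (x ∷ xs) = begin
  ∣ ⁅ x ⁆ ∪ toSet xs ∣     ≤⟨ ∣p∪q∣≤∣p∣+∣q∣ ⁅ x ⁆ (toSet xs) ⟩
  ∣ ⁅ x ⁆ ∣ + ∣ toSet xs ∣ ≡⟨ cong (_+ ∣ toSet xs ∣) (∣⁅x⁆∣≡1 x) ⟩
  suc ∣ toSet xs ∣         ≤⟨ s≤s (∣toSet∣≤length xs) ⟩
  suc (length xs)          ∎
  where open ≤-Reasoning

unique⇒length≤∣toSet∣ : ∀ {xs : List (Fin n)} → Unique xs → length xs ≤ ∣ toSet xs ∣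
unique⇒length≤∣toSet∣ {xs = []}     []              = z≤n
unique⇒length≤∣toSet∣ {xs = x ∷ xs} (x∉xs ∷ unique) =
  ≤-trans (s≤s (unique⇒length≤∣toSet∣ unique)) (p⊂q⇒∣p∣<∣q∣ (q⊆p∪q ⁅ x ⁆ (toSet xs) , x , p⊆p∪q (toSet xs) (x∈⁅x⁆ x) , x∉toSet))
  where
  x∉toSet : x ∉ toSet xs
  x∉toSet x∈ = All¬⇒¬Any x∉xs (∈-toSet⁻ xs x∈)

length≤∣p∣ : ∀ {xs : List (Fin n)} {p} → Unique xs → All (_∈ p) xs → length xs ≤ ∣ p ∣
length≤∣p∣ {xs = xs} unique xs⊆p =
  ≤-trans (unique⇒length≤∣toSet∣ unique) (p⊆q⇒∣p∣≤∣q∣ (λ x∈ → All.lookup xs⊆p (∈-toSet⁻ xs x∈)))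

double : ℕ → ℕ
double zero    = zero
double (suc t) = suc (suc (double t))

double-mono-≤ : ∀ {s t} → s ≤ t → double s ≤ double t
double-mono-≤ z≤n       = z≤n
double-mono-≤ (s≤s s≤t) = s≤s (s≤s (double-mono-≤ s≤t))

double-∸ : ∀ s t i → double (s + t) ∸ (i + double t) ≡ double s ∸ i
double-∸ s zero    i = cong₂ _∸_ (cong double (+-identityʳ s)) (+-identityʳ i)
double-∸ s (suc t) i = begin
  double (s + suc t) ∸ (i + suc (suc (double t)))  ≡⟨ cong₂ _∸_ (cong double (+-suc s t)) (trans (+-suc i _) (cong suc (+-suc i _))) ⟩
  double (suc (s + t)) ∸ suc (suc (i + double t))  ≡⟨ double-∸ s t i ⟩
  double s ∸ i                                     ∎
  where open ≡-Reasoning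

nth : ∀ {A : Set} → A → List A → ℕ → A
nth d []       _       = d
nth d (x ∷ xs) zero    = x
nth d (x ∷ xs) (suc i) = nth d xs i

applyUpTo-nth : ∀ {A : Set} (d : A) xs → applyUpTo (nth d xs) (length xs) ≡ xs
applyUpTo-nth d []       = refl
applyUpTo-nth d (x ∷ xs) = cong (x ∷_) (applyUpTo-nth d xs)

unique-applyUpTo⁻ : ∀ {A : Set} (g : ℕ → A) l → Unique (applyUpTo g l) → ∀ {i j} → i < l → j < l → g i ≡ g j → i ≡ j
unique-applyUpTo⁻ g (suc l) _              {zero}  {zero}  _         _         _   = refl
unique-applyUpTo⁻ g (suc l) (g₀∉ ∷ _)      {zero}  {suc j} _         (s≤s j<l) g₀≡ = ⊥-elim (Allₚ.applyUpTo⁻ (g ∘ suc) l g₀∉ j<l g₀≡)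
unique-applyUpTo⁻ g (suc l) (g₀∉ ∷ _)      {suc i} {zero}  (s≤s i<l) _         ≡g₀ = ⊥-elim (Allₚ.applyUpTo⁻ (g ∘ suc) l g₀∉ i<l (sym ≡g₀))
unique-applyUpTo⁻ g (suc l) (_ ∷ unique)   {suc i} {suc j} (s≤s i<l) (s≤s j<l) eq  = cong suc (unique-applyUpTo⁻ (g ∘ suc) l unique i<l j<l eq)

length≤n : ∀ {xs : List (Fin n)} → Unique xs → length xs ≤ n
length≤n {n} {xs} unique = ≤-trans (unique⇒length≤∣toSet∣ unique) (∣p∣≤n (toSet xs))

odd⇒double : ∀ {l} → Odd l → ∃[ m ] (l ≡ suc (double m))
odd⇒double odd-one      = 0 , refl
odd⇒double (odd-ss odd) with odd⇒double odd
... | m , refl = suc m , refl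

pair-view : ∀ {A : Set} (xs : List A) → length xs ≡ 2 → ∃[ u ] ∃[ v ] (xs ≡ u ∷ v ∷ [])
pair-view (u ∷ v ∷ []) _ = u , v , refl

a∈triple : ∀ (a b c : Fin n) → a ∈ triple a b c
a∈triple a b c = p⊆p∪q (⁅ b ⁆ ∪ ⁅ c ⁆) (x∈⁅x⁆ a)

b∈triple : ∀ (a b c : Fin n) → b ∈ triple a b c
b∈triple a b c = q⊆p∪q ⁅ a ⁆ _ (p⊆p∪q ⁅ c ⁆ (x∈⁅x⁆ b))

c∈triple : ∀ (a b c : Fin n) → c ∈ triple a b c
c∈triple a b c = q⊆p∪q ⁅ a ⁆ _ (q⊆p∪q ⁅ b ⁆ ⁅ c ⁆ (x∈⁅x⁆ c))

∈triple⁻ : ∀ {a b c x : Fin n} → x ∈ triple a b c → x ≡ a ⊎ x ≡ b ⊎ x ≡ c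
∈triple⁻ {a = a} {b} {c} x∈ with x∈p∪q⁻ ⁅ a ⁆ _ x∈
... | inj₁ x∈a = inj₁ (x∈⁅y⁆⇒x≡y a x∈a)
... | inj₂ x∈bc with x∈p∪q⁻ ⁅ b ⁆ ⁅ c ⁆ x∈bc
...   | inj₁ x∈b = inj₂ (inj₁ (x∈⁅y⁆⇒x≡y b x∈b))
...   | inj₂ x∈c = inj₂ (inj₂ (x∈⁅y⁆⇒x≡y c x∈c))

triple-⊆ : ∀ {a b c : Fin n} {p} → a ∈ p → b ∈ p → c ∈ p → triple a b c ⊆ p
triple-⊆ a∈p b∈p c∈p x∈ with ∈triple⁻ x∈
... | inj₁ refl        = a∈p
... | inj₂ (inj₁ refl) = b∈p
... | inj₂ (inj₂ refl) = c∈p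

triple-rotate : ∀ (a b c : Fin n) → triple a b c ≡ triple b c a
triple-rotate a b c = ⊆-antisym (triple-⊆ (c∈triple b c a) (a∈triple b c a) (b∈triple b c a))
                                (triple-⊆ (b∈triple a b c) (c∈triple a b c) (a∈triple a b c))

triple-reverse : ∀ (a b c : Fin n) → triple a b c ≡ triple c b a
triple-reverse a b c = ⊆-antisym (triple-⊆ (c∈triple c b a) (b∈triple c b a) (a∈triple c b a))
                                 (triple-⊆ (c∈triple a b c) (b∈triple a b c) (a∈triple a b c))

module _ {n : ℕ} (M : Matroid n) where

  rank≤rank⊤ : ∀ X → rank M X ≤ rank M ⊤
  rank≤rank⊤ X = r-mono M ⊆⊤

  rank-∪⁅⁆ : ∀ X t → rank M (X ∪ ⁅ t ⁆) ≤ suc (rank M X)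
  rank-∪⁅⁆ X t = begin
    rank M (X ∪ ⁅ t ⁆)                       ≤⟨ m≤m+n _ _ ⟩
    rank M (X ∪ ⁅ t ⁆) + rank M (X ∩ ⁅ t ⁆) ≤⟨ r-submod M X ⁅ t ⁆ ⟩
    rank M X + rank M ⁅ t ⁆                 ≤⟨ +-monoʳ-≤ (rank M X) (≤-trans (r-bound M ⁅ t ⁆) (≤-reflexive (∣⁅x⁆∣≡1 t))) ⟩
    rank M X + 1                            ≡⟨ +-comm (rank M X) 1 ⟩
    suc (rank M X)                          ∎
    where open ≤-Reasoning

  circuit-closure : ∀ {C Z t} → IsCircuit M C → t ∈ C → C - t ⊆ Z → rank M (Z ∪ ⁅ t ⁆) ≤ rank M Z
  circuit-closure {C} {Z} {t} (dependent , minimal) t∈C C-t⊆Z =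
    ≤-trans (r-mono M Z∪t⊆Z∪C) (+-cancelʳ-≤ (rank M (Z ∩ C)) _ _ submodular)
    where
    rC≤rC-t : rank M C ≤ rank M (C - t)
    rC≤rC-t = ≤-pred (begin-strict
      rank M C            <⟨ dependent ⟩
      ∣ C ∣               ≤⟨ ∣p∣≤suc∣p-x∣ C t ⟩
      suc ∣ C - t ∣       ≡⟨ cong suc (sym (minimal (C - t) (x∈p⇒p-x⊂p t∈C))) ⟩
      suc (rank M (C - t)) ∎)
      where open ≤-Reasoning
    submodular : rank M (Z ∪ C) + rank M (Z ∩ C) ≤ rank M Z + rank M (Z ∩ C)
    submodular = ≤-trans (r-submod M Z C)
      (+-monoʳ-≤ (rank M Z) (≤-trans rC≤rC-t (r-mono M (λ x∈ → x∈p∩q⁺ (C-t⊆Z x∈ , x∈p-y⇒x∈p x∈)))))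
    Z∪t⊆Z∪C : Z ∪ ⁅ t ⁆ ⊆ Z ∪ C
    Z∪t⊆Z∪C x∈ with x∈p∪q⁻ Z ⁅ t ⁆ x∈
    ... | inj₁ x∈Z = p⊆p∪q C x∈Z
    ... | inj₂ x∈t = q⊆p∪q Z C (subst (_∈ C) (sym (x∈⁅y⁆⇒x≡y t x∈t)) t∈C)

  triangle-closure : ∀ {a b c Z} → IsTriangle M (triple a b c) → a ∈ Z → b ∈ Z → rank M (Z ∪ ⁅ c ⁆) ≤ rank M Z
  triangle-closure {a} {b} {c} (circuit , _) a∈Z b∈Z = circuit-closure circuit (c∈triple a b c) T-c⊆Z
    where
    T-c⊆Z : triple a b c - c ⊆ _
    T-c⊆Z x∈ with ∈triple⁻ (x∈p-y⇒x∈p x∈)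
    ... | inj₁ refl        = a∈Z
    ... | inj₂ (inj₁ refl) = b∈Z
    ... | inj₂ (inj₂ refl) = contradiction refl (x∈p-y⇒x≢y x∈)

  triangle-rotate : ∀ {a b c} → IsTriangle M (triple a b c) → IsTriangle M (triple b c a)
  triangle-rotate {a} {b} {c} = subst (IsTriangle M) (triple-rotate a b c)

  triangle-reverse : ∀ {a b c} → IsTriangle M (triple a b c) → IsTriangle M (triple c b a)
  triangle-reverse {a} {b} {c} = subst (IsTriangle M) (triple-reverse a b c)

  triad-reverse : ∀ {a b c} → IsTriad M (triple a b c) → IsTriad M (triple c b a)
  triad-reverse {a} {b} {c} = subst (IsTriad M) (triple-reverse a b c)

  dualRank<∣X∣⇒rank∁<rank⊤ : ∀ X → dualRank M X < ∣ X ∣ → rank M (∁ X) < rank M ⊤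
  dualRank<∣X∣⇒rank∁<rank⊤ X dual< = ≰⇒> λ r⊤≤ → <⇒≱ dual< (begin
    ∣ X ∣                            ≡⟨ m+n∸n≡m ∣ X ∣ (rank M ⊤) ⟨
    ∣ X ∣ + rank M ⊤ ∸ rank M ⊤      ≤⟨ ∸-monoˡ-≤ (rank M ⊤) (+-monoʳ-≤ ∣ X ∣ r⊤≤) ⟩
    ∣ X ∣ + rank M (∁ X) ∸ rank M ⊤  ∎)
    where open ≤-Reasoning

  rank∁<rank⊤⇒dualRank<∣X∣ : ∀ X → 1 ≤ ∣ X ∣ → rank M (∁ X) < rank M ⊤ → dualRank M X < ∣ X ∣
  rank∁<rank⊤⇒dualRank<∣X∣ X 1≤∣X∣ r∁<r⊤ with ∣ X ∣ | 1≤∣X∣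
  ... | suc k | _ = s≤s (begin
    suc k + rank M (∁ X) ∸ rank M ⊤   ≡⟨ cong (_∸ rank M ⊤) (sym (+-suc k (rank M (∁ X)))) ⟩
    k + suc (rank M (∁ X)) ∸ rank M ⊤ ≤⟨ ∸-monoˡ-≤ (rank M ⊤) (+-monoʳ-≤ k r∁<r⊤) ⟩
    k + rank M ⊤ ∸ rank M ⊤           ≡⟨ m+n∸n≡m k (rank M ⊤) ⟩
    k                                 ∎)
    where open ≤-Reasoning

  cocircuit-rank : ∀ {D} → IsCocircuit M D → rank M (∁ D) < rank M ⊤
  cocircuit-rank {D} (dependent , _) = dualRank<∣X∣⇒rank∁<rank⊤ D dependent

  cocircuit-coclosure : ∀ {D Z t} → IsCocircuit M D → 2 ≤ ∣ D ∣ → t ∈ D → Z ⊆ ∁ D → rank M Z < rank M (Z ∪ ⁅ t ⁆)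
  cocircuit-coclosure {D} {Z} {t} cocircuit@(_ , minimal) 2≤∣D∣ t∈D Z⊆∁D =
    +-cancelʳ-≤ (rank M ⊤) _ _ (begin
      suc (rank M Z) + rank M ⊤                                   ≡⟨ cong suc (+-comm (rank M Z) (rank M ⊤)) ⟩
      suc (rank M ⊤ + rank M Z)                                   ≤⟨ s≤s (+-mono-≤ r⊤≤ (r-mono M Z⊆)) ⟩
      suc (rank M ((Z ∪ ⁅ t ⁆) ∪ ∁ D) + rank M ((Z ∪ ⁅ t ⁆) ∩ ∁ D)) ≤⟨ s≤s (r-submod M (Z ∪ ⁅ t ⁆) (∁ D)) ⟩
      suc (rank M (Z ∪ ⁅ t ⁆) + rank M (∁ D))                     ≡⟨ sym (+-suc _ _) ⟩
      rank M (Z ∪ ⁅ t ⁆) + suc (rank M (∁ D))                     ≤⟨ +-monoʳ-≤ _ (cocircuit-rank cocircuit) ⟩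
      rank M (Z ∪ ⁅ t ⁆) + rank M ⊤                               ∎)
    where
    open ≤-Reasoning
    1≤∣D-t∣ : 1 ≤ ∣ D - t ∣
    1≤∣D-t∣ = ≤-pred (≤-trans 2≤∣D∣ (∣p∣≤suc∣p-x∣ D t))
    r⊤≤ : rank M ⊤ ≤ rank M ((Z ∪ ⁅ t ⁆) ∪ ∁ D)
    r⊤≤ = ≤-trans (≮⇒≥ λ r∁<r⊤ → <-irrefl (minimal (D - t) (x∈p⇒p-x⊂p t∈D)) (rank∁<rank⊤⇒dualRank<∣X∣ (D - t) 1≤∣D-t∣ r∁<r⊤))
                  (r-mono M ∁[D-t]⊆)
      where
      ∁[D-t]⊆ : ∁ (D - t) ⊆ (Z ∪ ⁅ t ⁆) ∪ ∁ D
      ∁[D-t]⊆ {x} x∈ with x ≟ᶠ t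
      ... | yes refl = p⊆p∪q (∁ D) (q⊆p∪q Z ⁅ t ⁆ (x∈⁅x⁆ t))
      ... | no x≢t   = q⊆p∪q _ (∁ D) (x∉p⇒x∈∁p λ x∈D → x∈∁p⇒x∉p x∈ (x∈p∧x≢y⇒x∈p-y x∈D x≢t))
    Z⊆ : Z ⊆ (Z ∪ ⁅ t ⁆) ∩ ∁ D
    Z⊆ x∈Z = x∈p∩q⁺ (p⊆p∪q ⁅ t ⁆ x∈Z , Z⊆∁D x∈Z)

  triad-coclosure : ∀ {a b c Z t} → IsTriad M (triple a b c) → t ∈ triple a b c → Z ⊆ ∁ (triple a b c) →
                    rank M Z < rank M (Z ∪ ⁅ t ⁆)
  triad-coclosure (cocircuit , ∣T∣≡3) = cocircuit-coclosure cocircuit (≤-trans (n≤1+n 2) (≤-reflexive (sym ∣T∣≡3)))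

  -- C contains a cocircuit: E − C is not spanning.
  Codependent : List (Fin n) → Set
  Codependent C = rank M (∁ (toSet C)) < rank M ⊤

  codependent-⊆ : ∀ {C D} → C ⊆ₗ D → Codependent C → Codependent D
  codependent-⊆ {C} {D} C⊆D = ≤-<-trans (r-mono M ∁D⊆∁C)
    where
    ∁D⊆∁C : ∁ (toSet D) ⊆ ∁ (toSet C)
    ∁D⊆∁C x∈ = x∉p⇒x∈∁p λ x∈C → x∈∁p⇒x∉p x∈ (∈-toSet⁺ (C⊆D (∈-toSet⁻ C x∈C)))

  codependent-intro : ∀ {W} C → rank M W < rank M ⊤ → (∀ {x} → x ∉ₗ C → x ∈ W) → Codependent C
  codependent-intro C rW<r⊤ outside⊆W =
    ≤-<-trans (r-mono M (λ x∈ → outside⊆W λ x∈C → x∈∁p⇒x∉p x∈ (∈-toSet⁺ x∈C))) rW<r⊤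

  -- Orthogonality: a cocircuit never meets a triangle in exactly one element.
  codependent-remove : ∀ {a b t C} → IsTriangle M (triple a b t) → All (a ≢_) C → All (b ≢_) C →
                       Codependent (t ∷ C) → Codependent C
  codependent-remove {a} {b} {t} {C} (circuit , _) a∉C b∉C =
    ≤-<-trans (≤-trans (r-mono M ∁C⊆) (circuit-closure circuit (c∈triple a b t) T-t⊆))
    where
    ∉tC : ∀ {x} → All (x ≢_) C → x ≢ t → x ∈ ∁ (toSet (t ∷ C))
    ∉tC x∉C x≢t = x∉p⇒x∈∁p λ x∈tC → case ∈-toSet⁻ (t ∷ C) x∈tC of λ where
      (here x≡t)  → x≢t x≡t
      (there x∈C) → All¬⇒¬Any x∉C x∈C
    T-t⊆ : triple a b t - t ⊆ ∁ (toSet (t ∷ C))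
    T-t⊆ x∈ with ∈triple⁻ (x∈p-y⇒x∈p x∈)
    ... | inj₁ refl        = ∉tC a∉C (x∈p-y⇒x≢y x∈)
    ... | inj₂ (inj₁ refl) = ∉tC b∉C (x∈p-y⇒x≢y x∈)
    ... | inj₂ (inj₂ refl) = contradiction refl (x∈p-y⇒x≢y x∈)
    ∁C⊆ : ∁ (toSet C) ⊆ ∁ (toSet (t ∷ C)) ∪ ⁅ t ⁆
    ∁C⊆ {x} x∈ with x ≟ᶠ t
    ... | yes refl = q⊆p∪q _ ⁅ t ⁆ (x∈⁅x⁆ t)
    ... | no x≢t   = p⊆p∪q ⁅ t ⁆ (x∉p⇒x∈∁p λ x∈tC → case ∈-toSet⁻ (t ∷ C) x∈tC of λ where
      (here x≡t)  → x≢t x≡t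
      (there x∈C) → x∈∁p⇒x∉p x∈ (∈-toSet⁺ x∈C))

  minimal-codependent⇒cocircuit : ∀ {C x} → x ∈ₗ C → Codependent C →
    (∀ {t} → t ∈ₗ C → ∃[ D ] (¬ Codependent D × C ⊆ₗ t ∷ D)) → IsCocircuit M (toSet C)
  minimal-codependent⇒cocircuit {C} {x} x∈C codependent minimal =
    rank∁<rank⊤⇒dualRank<∣X∣ (toSet C) 1≤∣C∣ codependent , coindependent
    where
    1≤∣C∣ : 1 ≤ ∣ toSet C ∣
    1≤∣C∣ = length≤∣p∣ {xs = x ∷ []} ([] ∷ []) (∈-toSet⁺ x∈C ∷ [])
    coindependent : ∀ D → D ⊂ toSet C → dualRank M D ≡ ∣ D ∣
    coindependent D (D⊆C , t , t∈C , t∉D) with minimal (∈-toSet⁻ C t∈C)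
    ... | D′ , ¬codependent , C⊆tD′ =
      trans (cong (λ k → ∣ D ∣ + k ∸ rank M ⊤) r∁D≡r⊤) (m+n∸n≡m ∣ D ∣ (rank M ⊤))
      where
      ∁D′⊆∁D : ∁ (toSet D′) ⊆ ∁ D
      ∁D′⊆∁D {y} y∈ = x∉p⇒x∈∁p λ y∈D → case C⊆tD′ (∈-toSet⁻ C (D⊆C y∈D)) of λ where
        (here refl)  → t∉D y∈D
        (there y∈D′) → x∈∁p⇒x∉p y∈ (∈-toSet⁺ y∈D′)
      r∁D≡r⊤ : rank M (∁ D) ≡ rank M ⊤
      r∁D≡r⊤ = ≤-antisym (rank≤rank⊤ (∁ D)) (≤-trans (≮⇒≥ ¬codependent) (r-mono M ∁D′⊆∁D))

  rank-fan-prefix : ∀ (g : ℕ → Fin n) t →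
                    (∀ {s} → s < t → IsTriangle M (triple (g (double s)) (g (1 + double s)) (g (2 + double s)))) →
                    rank M (toSet (applyUpTo g (suc (double t)))) ≤ suc t
  rank-fan-prefix g zero    _         = ≤-trans (r-bound M _) (∣toSet∣≤length (g 0 ∷ []))
  rank-fan-prefix g (suc t) triangles = begin
    rank M (⁅ g 0 ⁆ ∪ (⁅ g 1 ⁆ ∪ Y)) ≡⟨ cong (rank M) (∪-comm ⁅ g 0 ⁆ _) ⟩
    rank M ((⁅ g 1 ⁆ ∪ Y) ∪ ⁅ g 0 ⁆) ≤⟨ triangle-closure (triangle-rotate (triangles z<s))
                                          (p⊆p∪q Y (x∈⁅x⁆ (g 1))) (q⊆p∪q ⁅ g 1 ⁆ Y (p⊆p∪q _ (x∈⁅x⁆ (g 2)))) ⟩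
    rank M (⁅ g 1 ⁆ ∪ Y)             ≡⟨ cong (rank M) (∪-comm ⁅ g 1 ⁆ Y) ⟩
    rank M (Y ∪ ⁅ g 1 ⁆)             ≤⟨ rank-∪⁅⁆ Y (g 1) ⟩
    suc (rank M Y)                   ≤⟨ s≤s (rank-fan-prefix (λ i → g (2 + i)) t λ s<t → triangles (s≤s s<t)) ⟩
    suc (suc t)                      ∎
    where
    open ≤-Reasoning
    Y : Subset n
    Y = toSet (applyUpTo (λ i → g (2 + i)) (suc (double t)))

SameSide : Subset n → Subset n → Fin n → Fin n → Set
SameSide A B p q = (p ∈ A × q ∈ A) ⊎ (p ∈ B × q ∈ B)

sameSide-swap : ∀ {A B : Subset n} {p q} → SameSide A B p q → SameSide B A p q
sameSide-swap (inj₁ in-A) = inj₂ in-A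
sameSide-swap (inj₂ in-B) = inj₁ in-B

sameSide-⊆ : ∀ {A A′ B B′ : Subset n} {p q} → A ⊆ A′ → B ⊆ B′ → SameSide A B p q → SameSide A′ B′ p q
sameSide-⊆ A⊆A′ _ (inj₁ (p∈A , q∈A)) = inj₁ (A⊆A′ p∈A , A⊆A′ q∈A)
sameSide-⊆ _ B⊆B′ (inj₂ (p∈B , q∈B)) = inj₂ (B⊆B′ p∈B , B⊆B′ q∈B)

sameSide-move : ∀ {A B : Subset n} {t p q} → p ≢ t → q ≢ t → SameSide A B p q → SameSide (A ∪ ⁅ t ⁆) (B - t) p q
sameSide-move {t = t} _   _   (inj₁ (p∈A , q∈A)) = inj₁ (p⊆p∪q ⁅ t ⁆ p∈A , p⊆p∪q ⁅ t ⁆ q∈A)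
sameSide-move         p≢t q≢t (inj₂ (p∈B , q∈B)) = inj₂ (x∈p∧x≢y⇒x∈p-y p∈B p≢t , x∈p∧x≢y⇒x∈p-y q∈B q≢t)

-- (A, B) is a j-separation of M \ D, except that ranks are compared with r(M) ≥ r(M \ D);
-- so every j-separation of M \ D is one.
record Separation {n} (M : Matroid n) (D : List (Fin n)) (j : ℕ) (A B : Subset n) : Set where
  field
    cover    : ∀ {x} → x ∉ₗ D → x ∈ A ⊎ x ∈ B
    disjoint : ∀ {x} → x ∈ A → x ∉ B
    D∩A≡∅    : ∀ {x} → x ∈ₗ D → x ∉ A
    D∩B≡∅    : ∀ {x} → x ∈ₗ D → x ∉ B
    j≤∣A∣    : j ≤ ∣ A ∣
    j≤∣B∣    : j ≤ ∣ B ∣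
    rank-sum : rank M A + rank M B < rank M ⊤ + j

module _ {n : ℕ} {M : Matroid n} where

  open Separation

  swap-sides : ∀ {D j A B} → Separation M D j A B → Separation M D j B A
  swap-sides {j = j} {A} {B} S = record
    { cover    = λ x∉D → Data.Sum.swap (cover S x∉D)
    ; disjoint = λ x∈B x∈A → disjoint S x∈A x∈B
    ; D∩A≡∅    = D∩B≡∅ S
    ; D∩B≡∅    = D∩A≡∅ S
    ; j≤∣A∣    = j≤∣B∣ S
    ; j≤∣B∣    = j≤∣A∣ S
    ; rank-sum = subst (_< rank M ⊤ + j) (+-comm (rank M A) (rank M B)) (rank-sum S)
    }

  absorb : ∀ {x D j A B} → Separation M (x ∷ D) j A B → x ∉ₗ D → rank M (A ∪ ⁅ x ⁆) ≤ rank M A →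
           Separation M D j (A ∪ ⁅ x ⁆) B
  absorb {x} {D} {j} {A} {B} S x∉D closed = record
    { cover    = cover′
    ; disjoint = disjoint′
    ; D∩A≡∅    = λ y∈D y∈A∪x → case x∈p∪q⁻ A ⁅ x ⁆ y∈A∪x of λ where
                   (inj₁ y∈A) → D∩A≡∅ S (there y∈D) y∈A
                   (inj₂ y∈x) → x∉D (subst (_∈ₗ D) (x∈⁅y⁆⇒x≡y x y∈x) y∈D)
    ; D∩B≡∅    = λ y∈D → D∩B≡∅ S (there y∈D)
    ; j≤∣A∣    = ≤-trans (j≤∣A∣ S) (∣p∣≤∣p∪q∣ A ⁅ x ⁆)
    ; j≤∣B∣    = j≤∣B∣ S
    ; rank-sum = ≤-<-trans (+-monoˡ-≤ (rank M B) closed) (rank-sum S)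
    }
    where
    cover′ : ∀ {y} → y ∉ₗ D → y ∈ A ∪ ⁅ x ⁆ ⊎ y ∈ B
    cover′ {y} y∉D with y ≟ᶠ x
    ... | yes refl = inj₁ (q⊆p∪q A ⁅ x ⁆ (x∈⁅x⁆ x))
    ... | no y≢x   = Data.Sum.map₁ (p⊆p∪q ⁅ x ⁆) (cover S λ { (here y≡x) → y≢x y≡x ; (there y∈D) → y∉D y∈D })
    disjoint′ : ∀ {y} → y ∈ A ∪ ⁅ x ⁆ → y ∉ B
    disjoint′ y∈A∪x with x∈p∪q⁻ A ⁅ x ⁆ y∈A∪x
    ... | inj₁ y∈A = disjoint S y∈A
    ... | inj₂ y∈x = subst (_∉ B) (sym (x∈⁅y⁆⇒x≡y x y∈x)) (D∩B≡∅ S (here refl))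

  move-coclosed : ∀ {D j A B a b c t} → Separation M D j A B → IsTriad M (triple a b c) → t ∈ triple a b c → t ∈ B →
                  (∀ {x} → x ∈ triple a b c → x ∈ B → x ≡ t) → suc j ≤ ∣ B ∣ → Separation M D j (A ∪ ⁅ t ⁆) (B - t)
  move-coclosed {D} {j} {A} {B} {t = t} S triad t∈T t∈B only-t sj≤∣B∣ = record
    { cover    = cover′
    ; disjoint = disjoint′
    ; D∩A≡∅    = λ x∈D x∈A∪t → case x∈p∪q⁻ A ⁅ t ⁆ x∈A∪t of λ where
                   (inj₁ x∈A) → D∩A≡∅ S x∈D x∈A
                   (inj₂ x∈t) → D∩B≡∅ S x∈D (subst (_∈ B) (sym (x∈⁅y⁆⇒x≡y t x∈t)) t∈B)
    ; D∩B≡∅    = λ x∈D x∈B-t → D∩B≡∅ S x∈D (x∈p-y⇒x∈p x∈B-t)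
    ; j≤∣A∣    = ≤-trans (j≤∣A∣ S) (∣p∣≤∣p∪q∣ A ⁅ t ⁆)
    ; j≤∣B∣    = ≤-pred (≤-trans sj≤∣B∣ (∣p∣≤suc∣p-x∣ B t))
    ; rank-sum = ≤-<-trans rank-sum-decreases (rank-sum S)
    }
    where
    open ≤-Reasoning
    B-t⊆∁T : B - t ⊆ ∁ _
    B-t⊆∁T x∈B-t = x∉p⇒x∈∁p λ x∈T → x∈p-y⇒x≢y x∈B-t (only-t x∈T (x∈p-y⇒x∈p x∈B-t))
    [B-t]∪t⊆B : (B - t) ∪ ⁅ t ⁆ ⊆ B
    [B-t]∪t⊆B x∈ = case x∈p∪q⁻ (B - t) ⁅ t ⁆ x∈ of λ where
      (inj₁ x∈B-t) → x∈p-y⇒x∈p x∈B-t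
      (inj₂ x∈t)   → subst (_∈ B) (sym (x∈⁅y⁆⇒x≡y t x∈t)) t∈B
    rank-sum-decreases : rank M (A ∪ ⁅ t ⁆) + rank M (B - t) ≤ rank M A + rank M B
    rank-sum-decreases = begin
      rank M (A ∪ ⁅ t ⁆) + rank M (B - t) ≤⟨ +-monoˡ-≤ (rank M (B - t)) (rank-∪⁅⁆ M A t) ⟩
      suc (rank M A + rank M (B - t))     ≡⟨ +-suc (rank M A) (rank M (B - t)) ⟨
      rank M A + suc (rank M (B - t))     ≤⟨ +-monoʳ-≤ (rank M A) (≤-trans (triad-coclosure M triad t∈T B-t⊆∁T) (r-mono M [B-t]∪t⊆B)) ⟩
      rank M A + rank M B                 ∎
    cover′ : ∀ {x} → x ∉ₗ D → x ∈ A ∪ ⁅ t ⁆ ⊎ x ∈ B - t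
    cover′ {x} x∉D with cover S x∉D | x ≟ᶠ t
    ... | inj₁ x∈A | _        = inj₁ (p⊆p∪q ⁅ t ⁆ x∈A)
    ... | inj₂ _   | yes refl = inj₁ (q⊆p∪q A ⁅ t ⁆ (x∈⁅x⁆ t))
    ... | inj₂ x∈B | no x≢t   = inj₂ (x∈p∧x≢y⇒x∈p-y x∈B x≢t)
    disjoint′ : ∀ {x} → x ∈ A ∪ ⁅ t ⁆ → x ∉ B - t
    disjoint′ x∈A∪t x∈B-t = case x∈p∪q⁻ A ⁅ t ⁆ x∈A∪t of λ where
      (inj₁ x∈A) → disjoint S x∈A (x∈p-y⇒x∈p x∈B-t)
      (inj₂ x∈t) → x∈p-y⇒x≢y x∈B-t (x∈⁅y⁆⇒x≡y t x∈t)

  ¬3-connected⇒separation : ∀ {a b} → ¬ ThreeConnectedOn (∁ (⁅ a ⁆ ∪ ⁅ b ⁆)) (rank M) →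
                            ∃[ j ] (1 ≤ j × j < 3 × ∃[ A ] ∃[ B ] Separation M (a ∷ b ∷ []) j A B)
  ¬3-connected⇒separation {a} {b} ¬3-connected = search (anySubset? (separating? 1)) (anySubset? (separating? 2))
    where
    E′ : Subset n
    E′ = ∁ (⁅ a ⁆ ∪ ⁅ b ⁆)
    Separating : ℕ → Subset n → Set
    Separating j X = X ⊆ E′ × j ≤ ∣ X ∣ × j ≤ ∣ E′ ∩ ∁ X ∣ × rank M X + rank M (E′ ∩ ∁ X) < rank M E′ + j
    separating? : ∀ j X → Dec (Separating j X)
    separating? j X = X ⊆? E′ ×-dec j ≤? ∣ X ∣ ×-dec j ≤? ∣ E′ ∩ ∁ X ∣ ×-dec _ <? _
    ∉E′ : ∀ {x} → x ∈ₗ a ∷ b ∷ [] → x ∉ E′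
    ∉E′ (here refl)         x∈E′ = x∈∁p⇒x∉p x∈E′ (p⊆p∪q ⁅ b ⁆ (x∈⁅x⁆ a))
    ∉E′ (there (here refl)) x∈E′ = x∈∁p⇒x∉p x∈E′ (q⊆p∪q ⁅ a ⁆ ⁅ b ⁆ (x∈⁅x⁆ b))
    toSeparation : ∀ {j X} → Separating j X → Separation M (a ∷ b ∷ []) j X (E′ ∩ ∁ X)
    toSeparation {j} {X} (X⊆E′ , j≤∣X∣ , j≤∣E′-X∣ , sum<) = record
      { cover    = cover′
      ; disjoint = λ x∈X x∈E′-X → x∈∁p⇒x∉p (proj₂ (x∈p∩q⁻ E′ (∁ X) x∈E′-X)) x∈X
      ; D∩A≡∅    = λ x∈D x∈X → ∉E′ x∈D (X⊆E′ x∈X)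
      ; D∩B≡∅    = λ x∈D x∈E′-X → ∉E′ x∈D (proj₁ (x∈p∩q⁻ E′ (∁ X) x∈E′-X))
      ; j≤∣A∣    = j≤∣X∣
      ; j≤∣B∣    = j≤∣E′-X∣
      ; rank-sum = <-≤-trans sum< (+-monoˡ-≤ j (rank≤rank⊤ M E′))
      }
      where
      cover′ : ∀ {x} → x ∉ₗ a ∷ b ∷ [] → x ∈ X ⊎ x ∈ E′ ∩ ∁ X
      cover′ {x} x∉D with x ∈? X
      ... | yes x∈X = inj₁ x∈X
      ... | no x∉X  = inj₂ (x∈p∩q⁺ (x∉p⇒x∈∁p x∉ab , x∉p⇒x∈∁p x∉X))
        where
        x∉ab : x ∉ ⁅ a ⁆ ∪ ⁅ b ⁆
        x∉ab x∈ab = case x∈p∪q⁻ ⁅ a ⁆ ⁅ b ⁆ x∈ab of λ where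
          (inj₁ x∈a) → x∉D (here (x∈⁅y⁆⇒x≡y a x∈a))
          (inj₂ x∈b) → x∉D (there (here (x∈⁅y⁆⇒x≡y b x∈b)))
    search : Dec (∃ (Separating 1)) → Dec (∃ (Separating 2)) →
             ∃[ j ] (1 ≤ j × j < 3 × ∃[ A ] ∃[ B ] Separation M (a ∷ b ∷ []) j A B)
    search (yes (X , separating)) _ = 1 , ≤-refl , s≤s (s≤s z≤n) , X , _ , toSeparation separating
    search (no _) (yes (X , separating)) = 2 , s≤s z≤n , ≤-refl , X , _ , toSeparation separating
    search (no ¬sep₁) (no ¬sep₂) = ⊥-elim (¬3-connected λ where
      1 _ _ X X⊆E′ separating → ¬sep₁ (X , X⊆E′ , separating)
      2 _ _ X X⊆E′ separating → ¬sep₂ (X , X⊆E′ , separating)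
      (suc (suc (suc _))) _ (s≤s (s≤s (s≤s ()))) _ _ _)

-- The pairs that survive moving c₁ or c₂ over to the side of c₃.
Unmoved : (c₁ c₂ c₃ p q : Fin n) → Set
Unmoved c₁ c₂ c₃ p q = (p ≢ c₁ × p ≢ c₂ × q ≢ c₁ × q ≢ c₂) ⊎ (p ≡ c₃ × q ≡ c₂)

data Gathered {n} (M : Matroid n) (D : List (Fin n)) (j : ℕ) (A B : Subset n) (c₁ c₂ c₃ : Fin n) : Set where
  together      : ∀ {A′ B′} → Separation M D j A′ B′ → SameSide A′ B′ c₁ c₂ →
                  (∀ {p q} → Unmoved c₁ c₂ c₃ p q → SameSide A B p q → SameSide A′ B′ p q) →
                  Gathered M D j A B c₁ c₂ c₃
  codependent₁ : ∀ y → Codependent M (c₁ ∷ y ∷ D) → Gathered M D j A B c₁ c₂ c₃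
  codependent₂ : ∀ y → y ≢ c₃ → Codependent M (c₂ ∷ y ∷ D) → Gathered M D j A B c₁ c₂ c₃

gathered-swap : ∀ {M : Matroid n} {D j A B c₁ c₂ c₃} → Gathered M D j B A c₁ c₂ c₃ → Gathered M D j A B c₁ c₂ c₃
gathered-swap (together S same preserved) = together S same λ unmoved same′ → preserved unmoved (sameSide-swap same′)
gathered-swap (codependent₁ y codependent)     = codependent₁ y codependent
gathered-swap (codependent₂ y y≢c₃ codependent) = codependent₂ y y≢c₃ codependent

module ThreeConnectedProperties {n : ℕ} {M : Matroid n} (connected : ThreeConnected M) (large : 5 ≤ n) where

  2≤∣∁X∣ : ∀ X → ∣ X ∣ ≤ 3 → 2 ≤ ∣ ∁ X ∣
  2≤∣∁X∣ X ∣X∣≤3 = ≤-trans (∸-mono large ∣X∣≤3) (≤-reflexive (sym (∣∁p∣≡n∸∣p∣ X)))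

  rank-sum-bound : ∀ {j} X → 1 ≤ j → j < 3 → j ≤ ∣ X ∣ → j ≤ ∣ ∁ X ∣ → rank M ⊤ + j ≤ rank M X + rank M (∁ X)
  rank-sum-bound X 1≤j j<3 j≤∣X∣ j≤∣∁X∣ = ≮⇒≥ λ sum< →
    connected _ 1≤j j<3 X ⊆⊤ (j≤∣X∣ , subst (λ Y → _ ≤ ∣ Y ∣) ⊤∩∁X≡∁X j≤∣∁X∣ ,
                              subst (λ Y → rank M X + rank M Y < _) ⊤∩∁X≡∁X sum<)
    where
    ⊤∩∁X≡∁X : ∁ X ≡ ⊤ ∩ ∁ X
    ⊤∩∁X≡∁X = sym (∩-identityˡ (∁ X))

  small-set-ranks : ∀ X → 1 ≤ ∣ X ∣ → ∣ X ∣ ≤ 2 → ∣ X ∣ ≤ rank M X × rank M ⊤ ≤ rank M (∁ X)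
  small-set-ranks X 1≤∣X∣ ∣X∣≤2 = independent , cospanning
    where
    open ≤-Reasoning
    bound : rank M ⊤ + ∣ X ∣ ≤ rank M X + rank M (∁ X)
    bound = rank-sum-bound X 1≤∣X∣ (s≤s ∣X∣≤2) ≤-refl (≤-trans ∣X∣≤2 (2≤∣∁X∣ X (m≤n⇒m≤1+n ∣X∣≤2)))
    independent : ∣ X ∣ ≤ rank M X
    independent = +-cancelʳ-≤ (rank M ⊤) _ _ (begin
      ∣ X ∣ + rank M ⊤           ≡⟨ +-comm ∣ X ∣ (rank M ⊤) ⟩
      rank M ⊤ + ∣ X ∣           ≤⟨ bound ⟩
      rank M X + rank M (∁ X)    ≤⟨ +-monoʳ-≤ (rank M X) (rank≤rank⊤ M (∁ X)) ⟩
      rank M X + rank M ⊤        ∎)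
    cospanning : rank M ⊤ ≤ rank M (∁ X)
    cospanning = +-cancelʳ-≤ ∣ X ∣ _ _ (begin
      rank M ⊤ + ∣ X ∣           ≤⟨ bound ⟩
      rank M X + rank M (∁ X)    ≤⟨ +-monoˡ-≤ (rank M (∁ X)) (r-bound M X) ⟩
      ∣ X ∣ + rank M (∁ X)       ≡⟨ +-comm ∣ X ∣ (rank M (∁ X)) ⟩
      rank M (∁ X) + ∣ X ∣       ∎)

  ¬codependent-≤2 : ∀ C → ∣ toSet C ∣ ≤ 2 → ¬ Codependent M C
  ¬codependent-≤2 C ∣C∣≤2 codependent with nonempty? (toSet C)
  ... | yes (x , x∈C) = <⇒≱ codependent (proj₂ (small-set-ranks (toSet C) 1≤∣C∣ ∣C∣≤2))
    where
    1≤∣C∣ : 1 ≤ ∣ toSet C ∣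
    1≤∣C∣ = length≤∣p∣ {xs = x ∷ []} ([] ∷ []) (x∈C ∷ [])
  ... | no empty = <⇒≱ codependent (r-mono M λ {x} _ → x∉p⇒x∈∁p λ x∈C → empty (x , x∈C))

  ¬codependent-pair : ∀ u v → ¬ Codependent M (u ∷ v ∷ [])
  ¬codependent-pair u v = ¬codependent-≤2 (u ∷ v ∷ []) (∣toSet∣≤length (u ∷ v ∷ []))

  rank-pair : ∀ {u v X} → u ≢ v → u ∈ X → v ∈ X → 2 ≤ rank M X
  rank-pair {u} {v} {X} u≢v u∈X v∈X = begin
    2                              ≤⟨ unique⇒length≤∣toSet∣ unique ⟩
    ∣ toSet (u ∷ v ∷ []) ∣         ≤⟨ proj₁ (small-set-ranks _ (≤-trans (s≤s z≤n) (unique⇒length≤∣toSet∣ unique))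
                                                                (∣toSet∣≤length (u ∷ v ∷ []))) ⟩
    rank M (toSet (u ∷ v ∷ []))    ≤⟨ r-mono M (λ x∈ → case ∈-toSet⁻ (u ∷ v ∷ []) x∈ of λ where
                                        (here refl)         → u∈X
                                        (there (here refl)) → v∈X) ⟩
    rank M X                       ∎
    where
    open ≤-Reasoning
    unique : Unique (u ∷ v ∷ [])
    unique = (u≢v ∷ []) ∷ [] ∷ []

  ¬triangle×triad : ∀ {T} → IsTriangle M T → ¬ IsTriad M T
  ¬triangle×triad {T} ((dependent , _) , ∣T∣≡3) (cocircuit , _) =
    <⇒≱ (begin-strict
      rank M T + rank M (∁ T) <⟨ +-mono-≤-< (≤-pred (subst (rank M T <_) ∣T∣≡3 dependent)) (cocircuit-rank M cocircuit) ⟩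
      2 + rank M ⊤            ≡⟨ +-comm 2 (rank M ⊤) ⟩
      rank M ⊤ + 2            ∎)
      (rank-sum-bound T (s≤s z≤n) ≤-refl (subst (2 ≤_) (sym ∣T∣≡3) (n≤1+n 2)) (2≤∣∁X∣ T (≤-reflexive ∣T∣≡3)))
    where open ≤-Reasoning

  codependent⇒triad : ∀ {a b c} → Unique (a ∷ b ∷ c ∷ []) → Codependent M (a ∷ b ∷ c ∷ []) → IsTriad M (triple a b c)
  codependent⇒triad {a} {b} {c} unique codependent =
    subst (IsTriad M) toSet≡triple (cocircuit , ≤-antisym (∣toSet∣≤length (a ∷ b ∷ c ∷ [])) (unique⇒length≤∣toSet∣ unique))
    where
    toSet≡triple : toSet (a ∷ b ∷ c ∷ []) ≡ triple a b c
    toSet≡triple = cong (λ X → ⁅ a ⁆ ∪ (⁅ b ⁆ ∪ X)) (∪-identityʳ ⁅ c ⁆)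
    cocircuit : IsCocircuit M (toSet (a ∷ b ∷ c ∷ []))
    cocircuit = minimal-codependent⇒cocircuit M (here refl) codependent λ where
      (here refl)                 → b ∷ c ∷ [] , ¬codependent-pair b c , λ y∈ → y∈
      (there (here refl))         → a ∷ c ∷ [] , ¬codependent-pair a c , ⊆-reflexive-↭ (↭-swap a b ↭-refl)
      (there (there (here refl))) → a ∷ b ∷ [] , ¬codependent-pair a b ,
                                    ⊆-reflexive-↭ (↭-trans (↭-prep a (↭-swap b c ↭-refl)) (↭-swap a c ↭-refl))

  open Separation

  ¬separation-[] : ∀ {j A B} → Separation M [] j A B → 1 ≤ j → j < 3 → ⊥
  ¬separation-[] {j} {A} {B} S 1≤j j<3 = <⇒≱ (rank-sum S) (begin
    rank M ⊤ + j            ≤⟨ rank-sum-bound A 1≤j j<3 (j≤∣A∣ S) (≤-trans (j≤∣B∣ S) (p⊆q⇒∣p∣≤∣q∣ B⊆∁A)) ⟩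
    rank M A + rank M (∁ A) ≤⟨ +-monoʳ-≤ (rank M A) (r-mono M ∁A⊆B) ⟩
    rank M A + rank M B     ∎)
    where
    open ≤-Reasoning
    B⊆∁A : B ⊆ ∁ A
    B⊆∁A x∈B = x∉p⇒x∈∁p λ x∈A → disjoint S x∈A x∈B
    ∁A⊆B : ∁ A ⊆ B
    ∁A⊆B x∈∁A = case cover S (λ ()) of λ where
      (inj₁ x∈A) → contradiction x∈A (x∈∁p⇒x∉p x∈∁A)
      (inj₂ x∈B) → x∈B

  small-side⇒codependent : ∀ {D j A B s} → Separation M D j A B → 1 ≤ j → j ≤ 2 → s ∈ B → ∣ B ∣ ≤ j →
                           ∃[ y ] (y ∈ B × Codependent M (s ∷ y ∷ D))
  small-side⇒codependent {D} {j} {A} {B} {s} S 1≤j j≤2 s∈B ∣B∣≤j = choose (nonempty? (B - s))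
    where
    rA<r⊤ : rank M A < rank M ⊤
    rA<r⊤ = +-cancelʳ-≤ j _ _ (begin
      suc (rank M A) + j   ≤⟨ +-monoʳ-≤ (suc (rank M A)) (≤-trans (j≤∣B∣ S) (proj₁ (small-set-ranks B 1≤∣B∣ (≤-trans ∣B∣≤j j≤2)))) ⟩
      suc (rank M A + rank M B) ≤⟨ rank-sum S ⟩
      rank M ⊤ + j         ∎)
      where
      open ≤-Reasoning
      1≤∣B∣ : 1 ≤ ∣ B ∣
      1≤∣B∣ = ≤-trans 1≤j (j≤∣B∣ S)
    outside-in-A : ∀ {y} → (∀ {x} → x ∈ B → x ≢ s → x ≢ y → ⊥) → ∀ {x} → x ∉ₗ s ∷ y ∷ D → x ∈ A
    outside-in-A only-s-y {x} x∉ = case cover S (λ x∈D → x∉ (there (there x∈D))) of λ where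
      (inj₁ x∈A) → x∈A
      (inj₂ x∈B) → ⊥-elim (only-s-y x∈B (λ x≡s → x∉ (here x≡s)) (λ x≡y → x∉ (there (here x≡y))))
    choose : Dec (Nonempty (B - s)) → ∃[ y ] (y ∈ B × Codependent M (s ∷ y ∷ D))
    choose (yes (y , y∈B-s)) = y , x∈p-y⇒x∈p y∈B-s , codependent-intro M (s ∷ y ∷ D) rA<r⊤ (outside-in-A λ x∈B x≢s x≢y →
      ≤⇒≯ (≤-trans ∣B∣≤j j≤2) (length≤∣p∣ (unique x≢s x≢y) (s∈B ∷ x∈p-y⇒x∈p y∈B-s ∷ x∈B ∷ [])))
      where
      unique : ∀ {x} → x ≢ s → x ≢ y → Unique (s ∷ y ∷ x ∷ [])
      unique x≢s x≢y = ((λ s≡y → x∈p-y⇒x≢y y∈B-s (sym s≡y)) ∷ ≢-sym x≢s ∷ []) ∷ (≢-sym x≢y ∷ []) ∷ [] ∷ []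
    choose (no B-s≡∅) = s , s∈B , codependent-intro M (s ∷ s ∷ D) rA<r⊤ (outside-in-A λ x∈B x≢s _ → B-s≡∅ (_ , x∈p∧x≢y⇒x∈p-y x∈B x≢s))

  gather-moving-c₂ : ∀ {D j A B c₁ c₂ c₃} → Separation M D j A B → 1 ≤ j → j ≤ 2 → IsTriad M (triple c₁ c₂ c₃) →
                     c₁ ∈ A → c₂ ∈ B → c₃ ∈ A → Gathered M D j A B c₁ c₂ c₃
  gather-moving-c₂ {D} {j} {A} {B} {c₁} {c₂} {c₃} S 1≤j j≤2 triad c₁∈A c₂∈B c₃∈A = move (suc j ≤? ∣ B ∣)
    where
    only-c₂ : ∀ {x} → x ∈ triple c₁ c₂ c₃ → x ∈ B → x ≡ c₂
    only-c₂ x∈T x∈B with ∈triple⁻ x∈T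
    ... | inj₁ refl        = contradiction x∈B (disjoint S c₁∈A)
    ... | inj₂ (inj₁ refl) = refl
    ... | inj₂ (inj₂ refl) = contradiction x∈B (disjoint S c₃∈A)
    preserved : ∀ {p q} → Unmoved c₁ c₂ c₃ p q → SameSide A B p q → SameSide (A ∪ ⁅ c₂ ⁆) (B - c₂) p q
    preserved (inj₁ (_ , p≢c₂ , _ , q≢c₂)) = sameSide-move p≢c₂ q≢c₂
    preserved (inj₂ (refl , refl)) (inj₁ (_ , c₂∈A)) = contradiction c₂∈B (disjoint S c₂∈A)
    preserved (inj₂ (refl , refl)) (inj₂ (c₃∈B , _)) = contradiction c₃∈B (disjoint S c₃∈A)
    move : Dec (suc j ≤ ∣ B ∣) → Gathered M D j A B c₁ c₂ c₃
    move (yes sj≤∣B∣) =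
      together (move-coclosed S triad (b∈triple c₁ c₂ c₃) c₂∈B only-c₂ sj≤∣B∣)
               (inj₁ (p⊆p∪q ⁅ c₂ ⁆ c₁∈A , q⊆p∪q A ⁅ c₂ ⁆ (x∈⁅x⁆ c₂))) preserved
    move (no sj≰∣B∣) with small-side⇒codependent S 1≤j j≤2 c₂∈B (≤-pred (≰⇒> sj≰∣B∣))
    ... | y , y∈B , codependent = codependent₂ y (λ { refl → disjoint S c₃∈A y∈B }) codependent

  gather-moving-c₁ : ∀ {D j A B c₁ c₂ c₃} → Separation M D j A B → 1 ≤ j → j ≤ 2 → IsTriad M (triple c₁ c₂ c₃) →
                     c₁ ∈ A → c₂ ∈ B → c₃ ∈ B → Gathered M D j A B c₁ c₂ c₃
  gather-moving-c₁ {D} {j} {A} {B} {c₁} {c₂} {c₃} S 1≤j j≤2 triad c₁∈A c₂∈B c₃∈B = move (suc j ≤? ∣ A ∣)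
    where
    only-c₁ : ∀ {x} → x ∈ triple c₁ c₂ c₃ → x ∈ A → x ≡ c₁
    only-c₁ x∈T x∈A with ∈triple⁻ x∈T
    ... | inj₁ refl        = refl
    ... | inj₂ (inj₁ refl) = contradiction c₂∈B (disjoint S x∈A)
    ... | inj₂ (inj₂ refl) = contradiction c₃∈B (disjoint S x∈A)
    preserved : ∀ {p q} → Unmoved c₁ c₂ c₃ p q → SameSide A B p q → SameSide (B ∪ ⁅ c₁ ⁆) (A - c₁) p q
    preserved (inj₁ (p≢c₁ , _ , q≢c₁ , _)) same = sameSide-move p≢c₁ q≢c₁ (sameSide-swap same)
    preserved (inj₂ (refl , refl)) (inj₁ (c₃∈A , _)) = contradiction c₃∈B (disjoint S c₃∈A)
    preserved (inj₂ (refl , refl)) (inj₂ in-B)       = inj₁ (Data.Product.map (p⊆p∪q ⁅ c₁ ⁆) (p⊆p∪q ⁅ c₁ ⁆) in-B)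
    move : Dec (suc j ≤ ∣ A ∣) → Gathered M D j A B c₁ c₂ c₃
    move (yes sj≤∣A∣) =
      together (move-coclosed (swap-sides S) triad (a∈triple c₁ c₂ c₃) c₁∈A only-c₁ sj≤∣A∣)
               (inj₁ (q⊆p∪q B ⁅ c₁ ⁆ (x∈⁅x⁆ c₁) , p⊆p∪q ⁅ c₁ ⁆ c₂∈B)) preserved
    move (no sj≰∣A∣) with small-side⇒codependent (swap-sides S) 1≤j j≤2 c₁∈A (≤-pred (≰⇒> sj≰∣A∣))
    ... | y , _ , codependent = codependent₁ y codependent

  gather : ∀ {D j A B c₁ c₂ c₃} → Separation M D j A B → 1 ≤ j → j ≤ 2 → IsTriad M (triple c₁ c₂ c₃) →
           c₁ ∉ₗ D → c₂ ∉ₗ D → c₃ ∉ₗ D → Gathered M D j A B c₁ c₂ c₃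
  gather S 1≤j j≤2 triad c₁∉D c₂∉D c₃∉D with cover S c₁∉D | cover S c₂∉D | cover S c₃∉D
  ... | inj₁ c₁∈A | inj₁ c₂∈A | _         = together S (inj₁ (c₁∈A , c₂∈A)) λ _ same → same
  ... | inj₂ c₁∈B | inj₂ c₂∈B | _         = together S (inj₂ (c₁∈B , c₂∈B)) λ _ same → same
  ... | inj₁ c₁∈A | inj₂ c₂∈B | inj₁ c₃∈A = gather-moving-c₂ S 1≤j j≤2 triad c₁∈A c₂∈B c₃∈A
  ... | inj₁ c₁∈A | inj₂ c₂∈B | inj₂ c₃∈B = gather-moving-c₁ S 1≤j j≤2 triad c₁∈A c₂∈B c₃∈B
  ... | inj₂ c₁∈B | inj₁ c₂∈A | inj₂ c₃∈B = gathered-swap (gather-moving-c₂ (swap-sides S) 1≤j j≤2 triad c₁∈B c₂∈A c₃∈B)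
  ... | inj₂ c₁∈B | inj₁ c₂∈A | inj₁ c₃∈A = gathered-swap (gather-moving-c₁ (swap-sides S) 1≤j j≤2 triad c₁∈B c₂∈A c₃∈A)

  absorb-pair : ∀ {x D j A B p q} → Separation M (x ∷ D) j A B → x ∉ₗ D → IsTriangle M (triple p q x) →
                SameSide A B p q → ∃[ A′ ] ∃[ B′ ] (Separation M D j A′ B′ × A ⊆ A′ × B ⊆ B′)
  absorb-pair {x} S x∉D triangle (inj₁ (p∈A , q∈A)) =
    _ , _ , absorb S x∉D (triangle-closure M triangle p∈A q∈A) , p⊆p∪q ⁅ x ⁆ , (λ y∈ → y∈)
  absorb-pair {x} S x∉D triangle (inj₂ (p∈B , q∈B)) =
    _ , _ , swap-sides (absorb (swap-sides S) x∉D (triangle-closure M triangle p∈B q∈B)) , (λ y∈ → y∈) , p⊆p∪q ⁅ x ⁆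

  ends-closed : ∀ {a b j A B p q p′ q′} → Separation M (a ∷ b ∷ []) j A B → 1 ≤ j → j < 3 → a ≢ b →
                IsTriangle M (triple p q a) → IsTriangle M (triple p′ q′ b) → SameSide A B p q → SameSide A B p′ q′ → ⊥
  ends-closed S 1≤j j<3 a≢b triangleᵃ triangleᵇ sameᵃ sameᵇ
    with absorb-pair S (λ { (here a≡b) → a≢b a≡b }) triangleᵃ sameᵃ
  ... | _ , _ , S′ , A⊆A′ , B⊆B′ with absorb-pair S′ (λ ()) triangleᵇ (sameSide-⊆ A⊆A′ B⊆B′ sameᵇ)
  ...   | _ , _ , S″ , _ = ¬separation-[] S″ 1≤j j<3

record OddFan {n} (M : Matroid n) (m : ℕ) (F : Subset n) : Set where
  field
    e         : ℕ → Fin n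
    triangle  : ∀ {t} → t < m → IsTriangle M (triple (e (double t)) (e (1 + double t)) (e (2 + double t)))
    triad     : ∀ {t} → suc t < m → IsTriad M (triple (e (1 + double t)) (e (2 + double t)) (e (3 + double t)))
    injective : ∀ {i j} → i ≤ double m → j ≤ double m → e i ≡ e j → i ≡ j
    ∈F        : ∀ {i} → i ≤ double m → e i ∈ F
    ∈F⁻       : ∀ {x} → x ∈ F → ∃[ i ] (i ≤ double m × e i ≡ x)

module _ {n : ℕ} {M : Matroid n} where

  reverse : ∀ {m F} → OddFan M m F → OddFan M m F
  reverse {m} {F} V = record
    { e         = e′
    ; triangle  = triangle′
    ; triad     = triad′
    ; injective = λ {i} {j} i≤2m j≤2m e′i≡e′j → begin
        i                        ≡⟨ m∸[m∸n]≡n i≤2m ⟨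
        double m ∸ (double m ∸ i) ≡⟨ cong (double m ∸_) (injective (m∸n≤m (double m) i) (m∸n≤m (double m) j) e′i≡e′j) ⟩
        double m ∸ (double m ∸ j) ≡⟨ m∸[m∸n]≡n j≤2m ⟩
        j                        ∎
    ; ∈F        = λ {i} _ → ∈F (m∸n≤m (double m) i)
    ; ∈F⁻       = λ x∈F → case ∈F⁻ x∈F of λ where
        (i , i≤2m , refl) → double m ∸ i , m∸n≤m (double m) i , cong e (m∸[m∸n]≡n i≤2m)
    }
    where
    open OddFan V
    open ≡-Reasoning
    e′ : ℕ → Fin n
    e′ i = e (double m ∸ i)
    mirror : ∀ {t} → t < m → ∃[ s ] (suc s + t ≡ m × ∀ i → double m ∸ (i + double t) ≡ double (suc s) ∸ i)
    mirror {t} t<m with m≤n⇒∃[o]m+o≡n t<m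
    ... | s , t+s≡m = s , s+t≡m , λ i → begin
      double m ∸ (i + double t)          ≡⟨ cong (λ m′ → double m′ ∸ (i + double t)) (sym s+t≡m) ⟩
      double (suc s + t) ∸ (i + double t) ≡⟨ double-∸ (suc s) t i ⟩
      double (suc s) ∸ i                 ∎
      where
      s+t≡m : suc s + t ≡ m
      s+t≡m = trans (cong suc (+-comm s t)) t+s≡m
    at : ∀ (P : Fin n → Fin n → Fin n → Set) {i j k i′ j′ k′} → i ≡ i′ → j ≡ j′ → k ≡ k′ →
         P (e i′) (e j′) (e k′) → P (e i) (e j) (e k)
    at P refl refl refl p = p
    triangle′ : ∀ {t} → t < m → IsTriangle M (triple (e′ (double t)) (e′ (1 + double t)) (e′ (2 + double t)))
    triangle′ t<m with mirror t<m
    ... | s , s+t≡m , index = at (λ a b c → IsTriangle M (triple a b c)) (index 0) (index 1) (index 2)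
                                (triangle-reverse M (triangle (≤-trans (s≤s (m≤m+n s _)) (≤-reflexive s+t≡m))))
    triad′ : ∀ {t} → suc t < m → IsTriad M (triple (e′ (1 + double t)) (e′ (2 + double t)) (e′ (3 + double t)))
    triad′ {t} st<m with mirror (<-trans (n<1+n t) st<m)
    ... | zero  , t+1≡m , _     = contradiction t+1≡m (<⇒≢ st<m)
    ... | suc s , s+t≡m , index = at (λ a b c → IsTriad M (triple a b c)) (index 1) (index 2) (index 3)
                                    (triad-reverse M (triad (≤-trans (s≤s (s≤s (m≤m+n s _))) (≤-reflexive s+t≡m))))

  Unextendable : ∀ {m F} → OddFan M m F → Set
  Unextendable {F = F} V = ∀ {y} → y ∉ F → ¬ IsTriad M (triple y (OddFan.e V 0) (OddFan.e V 1))

  triangle-windows : ∀ (g : ℕ → Fin n) l → Alternates M (applyUpTo g (3 + l)) → IsTriangle M (triple (g 0) (g 1) (g 2)) →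
                     ∀ {t} → double t ≤ l → IsTriangle M (triple (g (double t)) (g (1 + double t)) (g (2 + double t)))
  triangle-windows g l             _ triangle {zero} _ = triangle
  triangle-windows g (suc (suc l)) (to-triad , _ , _ , to-triangle , alternates) triangle {suc t} (s≤s (s≤s 2t≤l)) =
    triangle-windows (λ i → g (2 + i)) l alternates (to-triangle (to-triad triangle)) 2t≤l

  triad-windows : ∀ (g : ℕ → Fin n) l → Alternates M (applyUpTo g (3 + l)) → IsTriangle M (triple (g 0) (g 1) (g 2)) →
                  ∀ {t} → suc (double t) ≤ l → IsTriad M (triple (g (1 + double t)) (g (2 + double t)) (g (3 + double t)))
  triad-windows g (suc l)       (to-triad , _) triangle {zero} _ = to-triad triangle
  triad-windows g (suc (suc l)) (to-triad , _ , _ , to-triangle , alternates) triangle {suc t} (s≤s (s≤s 2t+1≤l)) =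
    triad-windows (λ i → g (2 + i)) l alternates (to-triangle (to-triad triangle)) 2t+1≤l

  list⇒fan : ∀ a b c rest m → length (a ∷ b ∷ c ∷ rest) ≡ suc (double (suc m)) → IsFanOrdering M (a ∷ b ∷ c ∷ rest) →
             IsTriangle M (triple a b c) → OddFan M (suc m) (toSet (a ∷ b ∷ c ∷ rest))
  list⇒fan a b c rest m length≡ (unique , _ , alternates) triangle = record
    { e         = g
    ; triangle  = λ t<m → triangle-windows g (double m) (subst (Alternates M) (sym g≡) alternates) triangle
                            (double-mono-≤ (≤-pred t<m))
    ; triad     = λ st<m → triad-windows g (double m) (subst (Alternates M) (sym g≡) alternates) triangle
                            (≤-trans (n≤1+n _) (double-mono-≤ (≤-pred st<m)))
    ; injective = λ i≤ j≤ → unique-applyUpTo⁻ g _ (subst Unique (sym g≡) unique) (s≤s i≤) (s≤s j≤)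
    ; ∈F        = ∈F
    ; ∈F⁻       = ∈F⁻
    }
    where
    xs : List (Fin n)
    xs = a ∷ b ∷ c ∷ rest
    g : ℕ → Fin n
    g = nth a xs
    g≡ : applyUpTo g (suc (double (suc m))) ≡ xs
    g≡ = trans (cong (applyUpTo g) (sym length≡)) (applyUpTo-nth a xs)
    ∈F : ∀ {i} → i ≤ double (suc m) → g i ∈ toSet xs
    ∈F {i} i≤ = subst (λ ys → g i ∈ toSet ys) g≡ (∈-toSet⁺ (∈-applyUpTo⁺ g (s≤s i≤)))
    ∈F⁻ : ∀ {x} → x ∈ toSet xs → ∃[ i ] (i ≤ double (suc m) × g i ≡ x)
    ∈F⁻ {x} x∈ with ∈-applyUpTo⁻ g (∈-toSet⁻ _ (subst (λ ys → x ∈ toSet ys) (sym g≡) x∈))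
    ... | i , i< , refl = i , ≤-pred i< , refl

  Conclusion : ∀ {k F} → OddFan M (2 + k) F → Set
  Conclusion {k} {F} V = k ≡ 0 × ∃[ z ] (z ∉ F × IsCocircuit M (toSet (e 0 ∷ e 2 ∷ e 4 ∷ z ∷ [])))
    where open OddFan V

module OddFanProperties {n : ℕ} {M : Matroid n} (connected : ThreeConnected M) (large : 5 ≤ n)
               {k : ℕ} {F : Subset n} (V : OddFan M (2 + k) F) (unextendable : Unextendable V) where

  open OddFan V
  open ThreeConnectedProperties {M = M} connected large

  last : ℕ
  last = double (2 + k)

  e-distinct : ∀ {i j} → i ≤ last → j ≤ last → i ≢ j → e i ≢ e j
  e-distinct i≤last j≤last i≢j = i≢j ∘ injective i≤last j≤last

  e≢e : ∀ i j {i≤last : True (i ≤? last)} {j≤last : True (j ≤? last)} {i≢j : False (i ≟ j)} → e i ≢ e j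
  e≢e i j {i≤last} {j≤last} {i≢j} = e-distinct (toWitness i≤last) (toWitness j≤last) (toWitnessFalse i≢j)

  e≢e-last : ∀ i {i<last : True (i <? last)} → e i ≢ e last
  e≢e-last i {i<last} = e-distinct (<⇒≤ (toWitness i<last)) ≤-refl (<⇒≢ (toWitness i<last))

  ∉ends : ∀ i {i≤last : True (i ≤? last)} {i<last : True (i <? last)} {i≢0 : False (i ≟ 0)} → e i ∉ₗ e 0 ∷ e last ∷ []
  ∉ends i {i≤last} {i<last} {i≢0} (here ei≡e₀)         = e-distinct (toWitness i≤last) z≤n (toWitnessFalse i≢0) ei≡e₀
  ∉ends i {i<last = i<last}   (there (here ei≡elast)) = e≢e-last i {i<last} ei≡elast

  triad-bound : ∀ {t} → suc t < 2 + k → 3 + double t < last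
  triad-bound (s≤s (s≤s t≤k)) = s≤s (s≤s (s≤s (s≤s (double-mono-≤ t≤k))))

  2+2t≤last : ∀ {t} → suc t < 2 + k → 2 + double t ≤ last
  2+2t≤last st<m = <⇒≤ (<-trans (n<1+n _) (triad-bound st<m))

  3+2t≤last : ∀ {t} → suc t < 2 + k → 3 + double t ≤ last
  3+2t≤last st<m = <⇒≤ (triad-bound st<m)

  ∉F⇒≢e : ∀ {y i} → y ∉ F → i ≤ last → y ≢ e i
  ∉F⇒≢e y∉F i≤last refl = y∉F (∈F i≤last)

  triad-tail-distinct : ∀ {t} → suc t < 2 + k → e (2 + double t) ≢ e (3 + double t)
  triad-tail-distinct st<m = e-distinct (2+2t≤last st<m) (3+2t≤last st<m) (<⇒≢ (n<1+n _))

  inner : ℕ → Subset n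
  inner t = toSet (applyUpTo (λ i → e (suc i)) (suc (double t)))

  ∈inner : ∀ {i t} → i ≤ double t → e (suc i) ∈ inner t
  ∈inner i≤2t = ∈-toSet⁺ (∈-applyUpTo⁺ (λ i → e (suc i)) (s≤s i≤2t))

  ∉inner : ∀ {i t} → suc (double t) < i → i ≤ last → e i ∉ inner t
  ∉inner {i} {t} 2t+1<i i≤last e∈ with ∈-applyUpTo⁻ (λ i → e (suc i)) (∈-toSet⁻ _ e∈)
  ... | j , j<2t+1 , ei≡esj = <⇒≢ sj<i (sym (injective i≤last (<⇒≤ (<-≤-trans sj<i i≤last)) ei≡esj))
    where
    sj<i : suc j < i
    sj<i = ≤-<-trans j<2t+1 2t+1<i

  e₀∉inner : ∀ {t} → t ≤ suc k → e 0 ∉ inner t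
  e₀∉inner t≤sk e₀∈ with ∈-applyUpTo⁻ (λ i → e (suc i)) (∈-toSet⁻ _ e₀∈)
  ... | j , j<2t+1 , e₀≡esj = 0≢1+n (injective z≤n (≤-trans j<2t+1 (m≤n⇒m≤1+n (s≤s (double-mono-≤ t≤sk)))) e₀≡esj)

  inner⊆F : ∀ {t} → t ≤ suc k → inner t ⊆ F
  inner⊆F t≤sk x∈ with ∈-applyUpTo⁻ (λ i → e (suc i)) (∈-toSet⁻ _ x∈)
  ... | j , j<2t+1 , refl = ∈F (≤-trans j<2t+1 (m≤n⇒m≤1+n (s≤s (double-mono-≤ t≤sk))))

  inner⊆inner : ∀ t → inner t ⊆ inner (suc t)
  inner⊆inner t x∈ with ∈-applyUpTo⁻ (λ i → e (suc i)) (∈-toSet⁻ _ x∈)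
  ... | j , j<2t+1 , refl = ∈inner {j} {suc t} (m≤n⇒m≤1+n (m≤n⇒m≤1+n (≤-pred j<2t+1)))

  -- S ─ inner (t + 1) avoids the t-th triad, so neither e₂ₜ₊₂ nor e₂ₜ₊₃ is in its closure.
  rank-gain-from-triads : ∀ S t → t ≤ suc k → (∀ {s} → s < t → e (2 + double s) ∈ S ⊎ e (3 + double s) ∈ S) →
            rank M (S ─ inner t) + t ≤ rank M (S ─ inner 0)
  rank-gain-from-triads S zero    _      _     = ≤-reflexive (+-identityʳ _)
  rank-gain-from-triads S (suc t) st≤sk meets = begin
    rank M (S ─ inner (suc t)) + suc t   ≡⟨ +-suc _ t ⟩
    suc (rank M (S ─ inner (suc t))) + t ≤⟨ +-monoˡ-≤ t step ⟩
    rank M (S ─ inner t) + t             ≤⟨ rank-gain-from-triads S t (m≤n⇒m≤1+n (≤-pred st≤sk)) (λ s<t → meets (m<n⇒m<1+n s<t)) ⟩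
    rank M (S ─ inner 0)                 ∎
    where
    open ≤-Reasoning
    T : Subset n
    T = triple (e (1 + double t)) (e (2 + double t)) (e (3 + double t))
    3+2t<last : 3 + double t < last
    3+2t<last = triad-bound (s≤s st≤sk)
    Z⊆∁T : S ─ inner (suc t) ⊆ ∁ T
    Z⊆∁T x∈ = x∉p⇒x∈∁p λ x∈T → x∈p─q⇒x∉q S _ x∈
      (triple-⊆ (∈inner {double t} {suc t} (m≤n⇒m≤1+n (n≤1+n _))) (∈inner {1 + double t} {suc t} (n≤1+n _))
                (∈inner {2 + double t} {suc t} ≤-refl) x∈T)
    step-with : ∀ {x} → x ∈ T → x ∈ S → x ∉ inner t → suc (rank M (S ─ inner (suc t))) ≤ rank M (S ─ inner t)
    step-with {x} x∈T x∈S x∉inner = ≤-trans (triad-coclosure M (triad {t} (s≤s st≤sk)) x∈T Z⊆∁T) (r-mono M Z∪x⊆)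
      where
      Z∪x⊆ : (S ─ inner (suc t)) ∪ ⁅ x ⁆ ⊆ S ─ inner t
      Z∪x⊆ z∈ = case x∈p∪q⁻ _ ⁅ x ⁆ z∈ of λ where
        (inj₁ z∈Z) → x∈p∧x∉q⇒x∈p─q (p─q⊆p S _ z∈Z) λ z∈inner → x∈p─q⇒x∉q S _ z∈Z (inner⊆inner t z∈inner)
        (inj₂ z∈x) → subst (_∈ S ─ inner t) (sym (x∈⁅y⁆⇒x≡y x z∈x)) (x∈p∧x∉q⇒x∈p─q x∈S x∉inner)
    step : suc (rank M (S ─ inner (suc t))) ≤ rank M (S ─ inner t)
    step = case meets (n<1+n t) of λ where
      (inj₁ e₂∈S) → step-with (b∈triple _ _ _) e₂∈S (∉inner (n<1+n _) (<⇒≤ (<-trans (n<1+n _) 3+2t<last)))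
      (inj₂ e₃∈S) → step-with (c∈triple _ _ _) e₃∈S (∉inner (s≤s (n≤1+n _)) (<⇒≤ 3+2t<last))

  3+k≤rank⊤ : 3 + k ≤ rank M ⊤
  3+k≤rank⊤ = begin
    2 + suc k                          ≤⟨ +-monoˡ-≤ (suc k) (rank-pair (e-distinct z≤n ≤-refl λ ()) (outer z≤n e₀∉) (outer ≤-refl e-last∉)) ⟩
    rank M (⊤ ─ inner (suc k)) + suc k ≤⟨ rank-gain-from-triads ⊤ (suc k) ≤-refl (λ _ → inj₁ ∈⊤) ⟩
    rank M (⊤ ─ inner 0)               ≤⟨ rank≤rank⊤ M _ ⟩
    rank M ⊤                           ∎
    where
    open ≤-Reasoning
    outer : ∀ {i} → i ≤ last → e i ∉ inner (suc k) → e i ∈ ⊤ ─ inner (suc k)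
    outer _ ∉inner′ = x∈p∧x∉q⇒x∈p─q ∈⊤ ∉inner′
    e₀∉ : e 0 ∉ inner (suc k)
    e₀∉ = e₀∉inner ≤-refl
    e-last∉ : e last ∉ inner (suc k)
    e-last∉ = ∉inner ≤-refl ≤-refl

  rank-F≤3+k : rank M F ≤ 3 + k
  rank-F≤3+k = ≤-trans (r-mono M F⊆) (rank-fan-prefix M e (2 + k) triangle)
    where
    F⊆ : F ⊆ toSet (applyUpTo e (suc last))
    F⊆ x∈F with ∈F⁻ x∈F
    ... | i , i≤last , refl = ∈-toSet⁺ (∈-applyUpTo⁺ e (s≤s i≤last))

  F-e₀-e₁ : Subset n
  F-e₀-e₁ = toSet (applyUpTo (λ i → e (2 + i)) (suc (double (suc k))))

  rank[F-e₀-e₁]<rank⊤ : rank M F-e₀-e₁ < rank M ⊤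
  rank[F-e₀-e₁]<rank⊤ = <-≤-trans (s≤s (rank-fan-prefix M (λ i → e (2 + i)) (suc k) λ s<sk → triangle (s≤s s<sk))) 3+k≤rank⊤

  ∈F-e₀-e₁ : ∀ {x} → x ∈ F → x ≢ e 0 → x ≢ e 1 → x ∈ F-e₀-e₁
  ∈F-e₀-e₁ x∈F x≢e₀ x≢e₁ with ∈F⁻ x∈F
  ... | 0           , _        , refl = contradiction refl x≢e₀
  ... | 1           , _        , refl = contradiction refl x≢e₁
  ... | suc (suc i) , i+2≤last , refl = ∈-toSet⁺ (∈-applyUpTo⁺ (λ i → e (2 + i)) (s≤s (≤-pred (≤-pred i+2≤last))))

  TriadTail : Fin n → Fin n → Set
  TriadTail x y = ∃[ t ] (suc t < 2 + k × e (2 + double t) ≡ x × e (3 + double t) ≡ y)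

  TailFree : List (Fin n) → Set
  TailFree C = ∀ {x y} → TriadTail x y → x ∈ₗ C → y ∈ₗ C → ⊥

  rank-∁F+2+k≤rank⊤ : ∀ C → All (_∈ F) C → TailFree C → Codependent M C → rank M (∁ F) + (2 + k) ≤ rank M ⊤
  rank-∁F+2+k≤rank⊤ C C⊆F tail-free codependent = begin
    rank M (∁ F) + (2 + k)                   ≡⟨ +-suc _ (suc k) ⟩
    suc (rank M (∁ F) + suc k)               ≤⟨ s≤s (+-monoˡ-≤ (suc k) (r-mono M ∁F⊆)) ⟩
    suc (rank M (S ─ inner (suc k)) + suc k) ≤⟨ s≤s (rank-gain-from-triads S (suc k) ≤-refl meets) ⟩
    suc (rank M (S ─ inner 0))               ≤⟨ s≤s (r-mono M (p─q⊆p S _)) ⟩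
    suc (rank M S)                           ≤⟨ codependent ⟩
    rank M ⊤                                 ∎
    where
    open ≤-Reasoning
    S : Subset n
    S = ∁ (toSet C)
    meets : ∀ {s} → s < suc k → e (2 + double s) ∈ S ⊎ e (3 + double s) ∈ S
    meets {s} s<sk with e (2 + double s) ∈? S
    ... | yes e₂∈S = inj₁ e₂∈S
    ... | no e₂∉S  = inj₂ (x∉p⇒x∈∁p λ e₃∈C →
                       tail-free (s , s≤s s<sk , refl , refl) (∈-toSet⁻ C (x∉∁p⇒x∈p e₂∉S)) (∈-toSet⁻ C e₃∈C))
    ∁F⊆ : ∁ F ⊆ S ─ inner (suc k)
    ∁F⊆ x∈∁F = x∈p∧x∉q⇒x∈p─q (x∉p⇒x∈∁p λ x∈C → x∈∁p⇒x∉p x∈∁F (All.lookup C⊆F (∈-toSet⁻ C x∈C)))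
                              (λ x∈inner → x∈∁p⇒x∉p x∈∁F (inner⊆F ≤-refl x∈inner))

  -- With r(F) ≤ k + 3 the hypothesis gives r(F) + r(E − F) ≤ r(M) + 1.
  ∣∁F∣≤1 : rank M (∁ F) + (2 + k) ≤ rank M ⊤ → ∣ ∁ F ∣ ≤ 1
  ∣∁F∣≤1 rank≤ = ≮⇒≥ λ 2≤∣∁F∣ → n≮n (rank M ⊤ + (3 + k)) (begin
    suc (rank M ⊤ + (3 + k))              ≡⟨ +-suc (rank M ⊤) (3 + k) ⟨
    rank M ⊤ + (2 + (2 + k))              ≡⟨ +-assoc (rank M ⊤) 2 (2 + k) ⟨
    rank M ⊤ + 2 + (2 + k)                ≤⟨ +-monoˡ-≤ (2 + k) (rank-sum-bound F (s≤s z≤n) ≤-refl 2≤∣F∣ 2≤∣∁F∣) ⟩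
    rank M F + rank M (∁ F) + (2 + k)     ≡⟨ +-assoc (rank M F) _ _ ⟩
    rank M F + (rank M (∁ F) + (2 + k))   ≤⟨ +-mono-≤ rank-F≤3+k rank≤ ⟩
    (3 + k) + rank M ⊤                    ≡⟨ +-comm (3 + k) (rank M ⊤) ⟩
    rank M ⊤ + (3 + k)                    ∎)
    where
    open ≤-Reasoning
    2≤∣F∣ : 2 ≤ ∣ F ∣
    2≤∣F∣ = length≤∣p∣ ((e≢e 0 1 ∷ []) ∷ [] ∷ []) (∈F z≤n ∷ ∈F (s≤s z≤n) ∷ [])

  ¬codependent-tail-free : ∀ C → All (_∈ F) C → TailFree C → ¬ Codependent M C
  ¬codependent-tail-free C C⊆F tail-free codependent with nonempty? (∁ F)
  ... | no F≡E = ¬codependent-pair (e 0) (e 1) (codependent-intro M (e 0 ∷ e 1 ∷ []) rank[F-e₀-e₁]<rank⊤ λ x∉ →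
    ∈F-e₀-e₁ (x∉∁p⇒x∈p λ x∈∁F → F≡E (_ , x∈∁F)) (λ x≡e₀ → x∉ (here x≡e₀)) (λ x≡e₁ → x∉ (there (here x≡e₁))))
  ... | yes (y , y∈∁F) = unextendable y∉F (codependent⇒triad unique (codependent-intro M (y ∷ e 0 ∷ e 1 ∷ []) rank[F-e₀-e₁]<rank⊤ λ x∉ →
    ∈F-e₀-e₁ (x∉∁p⇒x∈p (only-y λ x≡y → x∉ (here x≡y)))
             (λ x≡e₀ → x∉ (there (here x≡e₀))) (λ x≡e₁ → x∉ (there (there (here x≡e₁))))))
    where
    y∉F : y ∉ F
    y∉F = x∈∁p⇒x∉p y∈∁F
    only-y : ∀ {x} → x ≢ y → x ∉ ∁ F
    only-y x≢y x∈∁F = ≤⇒≯ (∣∁F∣≤1 (rank-∁F+2+k≤rank⊤ C C⊆F tail-free codependent))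
                          (length≤∣p∣ ((≢-sym x≢y ∷ []) ∷ [] ∷ []) (y∈∁F ∷ x∈∁F ∷ []))
    unique : Unique (y ∷ e 0 ∷ e 1 ∷ [])
    unique = (∉F⇒≢e y∉F z≤n ∷ ∉F⇒≢e y∉F (s≤s z≤n) ∷ []) ∷ (e≢e 0 1 ∷ []) ∷ [] ∷ []

  ¬codependent-with-ends : ∀ {x y} → x ∈ F → y ∈ F → ¬ TriadTail x y → ¬ TriadTail y x →
                           ¬ Codependent M (x ∷ y ∷ e 0 ∷ e last ∷ [])
  ¬codependent-with-ends {x} {y} x∈F y∈F ¬xy ¬yx =
    ¬codependent-tail-free _ (x∈F ∷ y∈F ∷ ∈F z≤n ∷ ∈F ≤-refl ∷ []) tail-free
    where
    interior : ∀ {i} → 1 ≤ i → i < last → e i ∈ₗ x ∷ y ∷ e 0 ∷ e last ∷ [] → e i ≡ x ⊎ e i ≡ y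
    interior _   _      (here ei≡x)                         = inj₁ ei≡x
    interior _   _      (there (here ei≡y))                 = inj₂ ei≡y
    interior 1≤i i<last (there (there (here ei≡e₀)))        = ⊥-elim (e-distinct (<⇒≤ i<last) z≤n (λ { refl → case 1≤i of λ () }) ei≡e₀)
    interior _   i<last (there (there (there (here ei≡e)))) = ⊥-elim (e-distinct (<⇒≤ i<last) ≤-refl (<⇒≢ i<last) ei≡e)
    tail-free : TailFree (x ∷ y ∷ e 0 ∷ e last ∷ [])
    tail-free (t , st<m , refl , refl) e₂∈ e₃∈ with interior (s≤s z≤n) (<-trans (n<1+n _) (triad-bound st<m)) e₂∈
                                                   | interior (s≤s z≤n) (triad-bound st<m) e₃∈
    ... | inj₁ e₂≡x | inj₂ e₃≡y = ¬xy (t , st<m , e₂≡x , e₃≡y)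
    ... | inj₂ e₂≡y | inj₁ e₃≡x = ¬yx (t , st<m , e₂≡y , e₃≡x)
    ... | inj₁ e₂≡x | inj₁ e₃≡x = triad-tail-distinct st<m (trans e₂≡x (sym e₃≡x))
    ... | inj₂ e₂≡y | inj₂ e₃≡y = triad-tail-distinct st<m (trans e₂≡y (sym e₃≡y))

  ¬codependent-e₁ : ∀ y → ¬ Codependent M (e 1 ∷ y ∷ e 0 ∷ e last ∷ [])
  ¬codependent-e₁ y codependent with y ∈? F
  ... | yes y∈F = ¬codependent-with-ends (∈F (s≤s z≤n)) y∈F
    (λ { (t , st<m , e₂≡e₁ , _) → e-distinct (2+2t≤last st<m) (s≤s z≤n) (λ ()) e₂≡e₁ })
    (λ { (t , st<m , _ , e₃≡e₁) → e-distinct (3+2t≤last st<m) (s≤s z≤n) (λ ()) e₃≡e₁ }) codependent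
  ... | no y∉F = unextendable y∉F (codependent⇒triad unique
                   (codependent-⊆ M (⊆-reflexive-↭ (↭-sym (shift (e 1) (y ∷ e 0 ∷ []) []))) without-last))
    where
    unique : Unique (y ∷ e 0 ∷ e 1 ∷ [])
    unique = (∉F⇒≢e y∉F z≤n ∷ ∉F⇒≢e y∉F (s≤s z≤n) ∷ []) ∷ (e≢e 0 1 ∷ []) ∷ [] ∷ []
    avoids : ∀ {i} → 2 ≤ i → i ≤ last → All (e i ≢_) (e 1 ∷ y ∷ e 0 ∷ [])
    avoids (s≤s (s≤s _)) i≤last = e-distinct i≤last (s≤s z≤n) (λ ()) ∷ ≢-sym (∉F⇒≢e y∉F i≤last) ∷ e-distinct i≤last z≤n (λ ()) ∷ []
    without-last : Codependent M (e 1 ∷ y ∷ e 0 ∷ [])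
    without-last = codependent-remove M (triangle (n<1+n (suc k)))
                     (avoids (s≤s (s≤s z≤n)) (m≤n⇒m≤1+n (n≤1+n _))) (avoids (s≤s (s≤s z≤n)) (n≤1+n _))
                     (codependent-⊆ M (⊆-reflexive-↭ (shift (e last) (e 1 ∷ y ∷ e 0 ∷ []) [])) codependent)

  ¬codependent-e₂-∈F : ∀ {y} → y ∈ F → y ≢ e 3 → ¬ Codependent M (e 2 ∷ y ∷ e 0 ∷ e last ∷ [])
  ¬codependent-e₂-∈F {y} y∈F y≢e₃ = ¬codependent-with-ends (∈F (s≤s (s≤s z≤n))) y∈F first second
    where
    first : ¬ TriadTail (e 2) y
    first (zero  , _    , _     , e₃≡y) = y≢e₃ (sym e₃≡y)
    first (suc _ , st<m , e₄≡e₂ , _)    = e-distinct (2+2t≤last st<m) (s≤s (s≤s z≤n)) (λ ()) e₄≡e₂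
    second : ¬ TriadTail y (e 2)
    second (_ , st<m , _ , e₃≡e₂) = e-distinct (3+2t≤last st<m) (s≤s (s≤s z≤n)) (λ ()) e₃≡e₂

module _ {n : ℕ} {M : Matroid n} (connected : ThreeConnected M) (large : 5 ≤ n) where

  open ThreeConnectedProperties {M = M} connected large

  codependent-e₂⇒cocircuit : ∀ {F} (V : OddFan M 2 F) → Unextendable V → let open OddFan V in
                             ∀ {y} → y ∉ F → Codependent M (e 2 ∷ y ∷ e 0 ∷ e 4 ∷ []) →
                             IsCocircuit M (toSet (e 0 ∷ e 2 ∷ e 4 ∷ y ∷ []))
  codependent-e₂⇒cocircuit {F} V unextendable {y} y∉F codependent =
    minimal-codependent⇒cocircuit M (here refl) (codependent-⊆ M sorted codependent) minimal
    where
    open OddFan V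
    open OddFanProperties connected large V unextendable
    sorted : e 2 ∷ y ∷ e 0 ∷ e 4 ∷ [] ⊆ₗ e 0 ∷ e 2 ∷ e 4 ∷ y ∷ []
    sorted (here refl)                         = there (here refl)
    sorted (there (here refl))                 = there (there (there (here refl)))
    sorted (there (there (here refl)))         = here refl
    sorted (there (there (there (here refl)))) = there (there (here refl))
    spokes⊆ : e 0 ∷ e 2 ∷ e 4 ∷ [] ⊆ₗ e 2 ∷ e 4 ∷ e 0 ∷ e 4 ∷ []
    spokes⊆ (here refl)                 = there (there (here refl))
    spokes⊆ (there (here refl))         = here refl
    spokes⊆ (there (there (here refl))) = there (here refl)
    avoids : ∀ i {i≤4 : True (i ≤? 4)} {i≢4 : False (i ≟ 4)} → All (e i ≢_) (e 4 ∷ y ∷ [])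
    avoids i {i≤4} {i≢4} = e-distinct (toWitness i≤4) ≤-refl (toWitnessFalse i≢4) ∷ ≢-sym (∉F⇒≢e y∉F (toWitness i≤4)) ∷ []
    minimal : ∀ {t} → t ∈ₗ e 0 ∷ e 2 ∷ e 4 ∷ y ∷ [] → ∃[ D ] (¬ Codependent M D × e 0 ∷ e 2 ∷ e 4 ∷ y ∷ [] ⊆ₗ t ∷ D)
    minimal (here refl) = e 2 ∷ e 4 ∷ y ∷ [] ,
      ¬codependent-pair (e 4) y ∘ codependent-remove M (triangle z<s) (avoids 0) (avoids 1) ,
      λ x∈ → x∈
    minimal (there (here refl)) = e 0 ∷ e 4 ∷ y ∷ [] ,
      ¬codependent-pair (e 4) y ∘ codependent-remove M (triangle-rotate M (triangle z<s)) (avoids 1) (avoids 2) ,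
      ⊆-reflexive-↭ (↭-swap _ _ ↭-refl)
    minimal (there (there (here refl))) = e 0 ∷ e 2 ∷ y ∷ [] ,
      (λ codependent′ → ¬codependent-pair (e 0) y (codependent-remove M (triangle-rotate M (triangle (s≤s (s≤s z≤n))))
        (e≢e 3 0 ∷ ≢-sym (∉F⇒≢e y∉F (s≤s (s≤s (s≤s z≤n)))) ∷ []) (e≢e 4 0 ∷ ≢-sym (∉F⇒≢e y∉F ≤-refl) ∷ [])
        (codependent-⊆ M (⊆-reflexive-↭ (↭-swap _ _ (↭-refl {xs = y ∷ []}))) codependent′))) ,
      ⊆-reflexive-↭ (shift (e 4) (e 0 ∷ e 2 ∷ []) (y ∷ []))
    minimal (there (there (there (here refl)))) = e 0 ∷ e 2 ∷ e 4 ∷ [] ,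
      ¬codependent-e₂-∈F (∈F ≤-refl) (e≢e 4 3) ∘ codependent-⊆ M spokes⊆ ,
      ⊆-reflexive-↭ (shift y (e 0 ∷ e 2 ∷ e 4 ∷ []) [])

  ¬codependent-e₂-∉F : ∀ {k F} (V : OddFan M (3 + k) F) → Unextendable V → let open OddFan V in
                       ∀ {y} → y ∉ F → ¬ Codependent M (e 2 ∷ y ∷ e 0 ∷ e (double (3 + k)) ∷ [])
  ¬codependent-e₂-∉F {k} {F} V unextendable {y} y∉F =
    ¬codependent-pair y (e last) ∘ without-e₀ ∘ without-e₂
    where
    open OddFan V
    open OddFanProperties connected large V unextendable
    without-e₂ : Codependent M (e 2 ∷ y ∷ e 0 ∷ e last ∷ []) → Codependent M (y ∷ e 0 ∷ e last ∷ [])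
    without-e₂ = codependent-remove M (triangle-rotate M (triangle (s≤s (s≤s z≤n))))
      (≢-sym (∉F⇒≢e y∉F (s≤s (s≤s (s≤s z≤n)))) ∷ e≢e 3 0 ∷ e≢e-last 3 ∷ [])
      (≢-sym (∉F⇒≢e y∉F (s≤s (s≤s (s≤s (s≤s z≤n))))) ∷ e≢e 4 0 ∷ e≢e-last 4 ∷ [])
    without-e₀ : Codependent M (y ∷ e 0 ∷ e last ∷ []) → Codependent M (y ∷ e last ∷ [])
    without-e₀ = codependent-remove M (triangle-rotate M (triangle z<s))
      (≢-sym (∉F⇒≢e y∉F (s≤s z≤n)) ∷ e≢e-last 1 ∷ []) (≢-sym (∉F⇒≢e y∉F (s≤s (s≤s z≤n))) ∷ e≢e-last 2 ∷ [])
      ∘ codependent-⊆ M (⊆-reflexive-↭ (↭-swap _ _ (↭-refl {xs = e last ∷ []})))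

  codependent-e₂⇒conclusion : ∀ {k F} (V : OddFan M (2 + k) F) → Unextendable V → let open OddFan V in
                              ∀ {y} → y ≢ e 3 → Codependent M (e 2 ∷ y ∷ e 0 ∷ e (double (2 + k)) ∷ []) → Conclusion V
  codependent-e₂⇒conclusion {k} {F} V unextendable {y} y≢e₃ codependent with y ∈? F | k
  ... | yes y∈F | _     = ⊥-elim (¬codependent-e₂-∈F y∈F y≢e₃ codependent)
    where open OddFanProperties connected large V unextendable
  ... | no y∉F  | zero  = refl , y , y∉F , codependent-e₂⇒cocircuit V unextendable y∉F codependent
  ... | no y∉F  | suc _ = ⊥-elim (¬codependent-e₂-∉F V unextendable y∉F codependent)

  conclusion-reverse : ∀ {k F} (V : OddFan M (2 + k) F) → Conclusion (reverse V) → Conclusion V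
  conclusion-reverse V (refl , z , z∉F , cocircuit) = refl , z , z∉F , subst (IsCocircuit M) (toSet-↭ mirrored) cocircuit
    where
    open OddFan V
    mirrored : e 4 ∷ e 2 ∷ e 0 ∷ z ∷ [] ↭ e 0 ∷ e 2 ∷ e 4 ∷ z ∷ []
    mirrored = ↭-trans (↭-swap _ _ ↭-refl) (↭-trans (↭-prep _ (↭-swap _ _ ↭-refl)) (↭-swap _ _ ↭-refl))

  -- The last triad, read backwards, is (e₂ₘ₋₁, e₂ₘ₋₂, e₂ₘ₋₃); for m = 2 it is the first triad.
  last-triad-unmoved : ∀ {k F} (V : OddFan M (2 + k) F) → let open OddFan V in
                       Unmoved (e (3 + double k)) (e (2 + double k)) (e (1 + double k)) (e 1) (e 2)
  last-triad-unmoved {zero}  V = inj₂ (refl , refl)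
  last-triad-unmoved {suc k} V = inj₁ (apart (s≤s z≤n) (n≤1+n _) , apart (s≤s z≤n) (m≤n⇒m≤1+n (n≤1+n _)) ,
                                       apart ≤-refl (n≤1+n _) , apart ≤-refl (m≤n⇒m≤1+n (n≤1+n _)))
    where
    open OddFan V
    apart : ∀ {i j} → i ≤ 2 → j ≤ double (3 + k) → {2<j : True (2 <? j)} → e i ≢ e j
    apart i≤2 j≤last {2<j} = <⇒≢ i<j ∘ injective (<⇒≤ (<-≤-trans i<j j≤last)) j≤last
      where
      i<j : _ < _
      i<j = ≤-<-trans i≤2 (toWitness 2<j)

  fan-conclusion : ∀ {k F} (V : OddFan M (2 + k) F) → Unextendable V → Unextendable (reverse V) →
                   ¬ ThreeConnectedOn (∁ (⁅ OddFan.e V 0 ⁆ ∪ ⁅ OddFan.e V (double (2 + k)) ⁆)) (rank M) → Conclusion V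
  fan-conclusion {k} {F} V unextendable unextendableʳ ¬3-connected = by-separation (¬3-connected⇒separation ¬3-connected)
    where
    open OddFan V
    open OddFanProperties connected large V unextendable
    module Rev = OddFan (reverse V)
    module RevEnds = OddFanProperties connected large (reverse V) unextendableʳ
    ends : List (Fin n)
    ends = e 0 ∷ e last ∷ []
    ends↭ : ends ↭ Rev.e 0 ∷ Rev.e last ∷ []
    ends↭ = subst (λ x → ends ↭ e last ∷ x ∷ []) (cong e (sym (n∸n≡0 last))) (↭-swap _ _ ↭-refl)
    mirror : ∀ {c y} → Codependent M (c ∷ y ∷ ends) → Codependent M (c ∷ y ∷ Rev.e 0 ∷ Rev.e last ∷ [])
    mirror = codependent-⊆ M (⊆-reflexive-↭ (↭-prep _ (↭-prep _ ends↭)))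
    ∉endsʳ : ∀ i {i≤last : True (i ≤? last)} {i<last : True (i <? last)} {i≢0 : False (i ≟ 0)} → Rev.e i ∉ₗ ends
    ∉endsʳ i {i≤last} {i<last} {i≢0} = RevEnds.∉ends i {i≤last} {i<last} {i≢0} ∘ ⊆-reflexive-↭ ends↭
    by-separation : ∃[ j ] (1 ≤ j × j < 3 × ∃[ A ] ∃[ B ] Separation M ends j A B) → Conclusion V
    by-separation (j , 1≤j , j<3 , _ , _ , S) = front (gather S 1≤j (≤-pred j<3) (triad (s≤s (s≤s z≤n))) (∉ends 1) (∉ends 2) (∉ends 3))
      where
      front : ∀ {A B} → Gathered M ends j A B (e 1) (e 2) (e 3) → Conclusion V
      front (codependent₁ y codependent)      = ⊥-elim (¬codependent-e₁ y codependent)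
      front (codependent₂ y y≢e₃ codependent) = codependent-e₂⇒conclusion V unextendable y≢e₃ codependent
      front (together {A′} {B′} S′ front-together _) =
        back (gather S′ 1≤j (≤-pred j<3) (Rev.triad (s≤s (s≤s z≤n))) (∉endsʳ 1) (∉endsʳ 2) (∉endsʳ 3))
        where
        back : Gathered M ends j A′ B′ (Rev.e 1) (Rev.e 2) (Rev.e 3) → Conclusion V
        back (codependent₁ y codependent)      = ⊥-elim (RevEnds.¬codependent-e₁ y (mirror codependent))
        back (codependent₂ y y≢e₃ codependent) =
          conclusion-reverse V (codependent-e₂⇒conclusion (reverse V) unextendableʳ y≢e₃ (mirror codependent))
        back (together S″ back-together preserved) =
          ⊥-elim (ends-closed S″ 1≤j j<3 (e≢e-last 0) (triangle-rotate M (triangle z<s)) (triangle-rotate M (Rev.triangle z<s))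
                              (preserved (last-triad-unmoved V) front-together) back-together)

  alternates-intro : ∀ (g : ℕ → Fin n) m →
                     (∀ {t} → t < m → IsTriangle M (triple (g (double t)) (g (1 + double t)) (g (2 + double t)))) →
                     (∀ {t} → suc t < m → IsTriad M (triple (g (1 + double t)) (g (2 + double t)) (g (3 + double t)))) →
                     Alternates M (applyUpTo g (suc (double m)))
  alternates-intro g zero          _         _      = tt
  alternates-intro g (suc zero)    _         _      = tt
  alternates-intro g (suc (suc m)) triangles triads =
    (λ _ → triads (s≤s (s≤s z≤n))) ,
    (λ triad → ⊥-elim (¬triangle×triad (triangles z<s) triad)) ,
    (λ triangle → ⊥-elim (¬triangle×triad triangle (triads (s≤s (s≤s z≤n))))) ,
    (λ _ → triangles (s≤s z<s)) ,
    alternates-intro (λ i → g (2 + i)) (suc m) (λ t<m → triangles (s≤s t<m)) (λ st<m → triads (s≤s st<m))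

  maximal⇒unextendable : ∀ {k F} (V : OddFan M (2 + k) F) → IsMaximalFan M F → Unextendable V
  maximal⇒unextendable {k} {F} V (_ , maximal) {y} y∉F y-triad =
    maximal (toSet (y ∷ elements)) (F⊆ , y , ∈-toSet⁺ {xs = y ∷ elements} (here refl) , y∉F)
      (inj₂ (y ∷ elements , (unique , inj₂ y-triad , (λ y-triangle → ⊥-elim (¬triangle×triad y-triangle y-triad)) ,
                             (λ _ → triangle z<s) , alternates-intro e (2 + k) triangle triad) , refl))
    where
    open OddFan V
    elements : List (Fin n)
    elements = applyUpTo e (suc (double (2 + k)))
    F⊆ : F ⊆ toSet (y ∷ elements)
    F⊆ x∈F with ∈F⁻ x∈F
    ... | i , i≤ , refl = ∈-toSet⁺ (there (∈-applyUpTo⁺ e (s≤s i≤)))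
    unique : Unique (y ∷ elements)
    unique = Allₚ.applyUpTo⁺₁ e _ (λ i< y≡ → y∉F (subst (_∈ F) (sym y≡) (∈F (≤-pred i<))))
           ∷ Uniqueₚ.applyUpTo⁺₁ e _ λ i<j j<l → <⇒≢ i<j ∘ injective (≤-pred (<-trans i<j j<l)) (≤-pred j<l)

  odd-fan-theorem : ∀ {a b c rest k} (ordering : IsFanOrdering M (a ∷ b ∷ c ∷ rest)) →
                    IsMaximalFan M (toSet (a ∷ b ∷ c ∷ rest)) →
                    NoDetachablePairs M → (length≡ : length (a ∷ b ∷ c ∷ rest) ≡ suc (double (2 + k))) →
                    (triangle : IsTriangle M (triple a b c)) → Conclusion (list⇒fan a b c rest (suc k) length≡ ordering triangle)
  odd-fan-theorem {a} {b} {c} {rest} {k} ordering maximal no-detachable length≡ triangle =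
    fan-conclusion V (maximal⇒unextendable V maximal) (maximal⇒unextendable (reverse V) maximal)
      λ 3-connected → no-detachable (e 0) (e (double (2 + k))) e₀≢e-last (inj₁ 3-connected)
    where
    V : OddFan M (2 + k) (toSet (a ∷ b ∷ c ∷ rest))
    V = list⇒fan a b c rest (suc k) length≡ ordering triangle
    open OddFan V
    e₀≢e-last : e 0 ≢ e (double (2 + k))
    e₀≢e-last e₀≡ = case injective z≤n ≤-refl e₀≡ of λ ()

lemma5p16 : ∀ {n : ℕ} (M : Matroid n) → ThreeConnected M → NoDetachablePairs M →
    ∀ (xs : List (Fin n)) → IsFanOrdering M xs → IsMaximalFan M (toSet xs) →
    Odd (length xs) → 5 ≤ length xs →
    ∀ (e₁ e₂ e₃ : Fin n) (rest : List (Fin n)) → xs ≡ e₁ ∷ e₂ ∷ e₃ ∷ rest →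
    IsTriangle M (triple e₁ e₂ e₃) →
    Σ (Fin n) λ e₄ → Σ (Fin n) λ e₅ → (xs ≡ e₁ ∷ e₂ ∷ e₃ ∷ e₄ ∷ e₅ ∷ [] ×
      Σ (Fin n) λ z → (z ∉ toSet xs × IsCocircuit M (⁅ e₁ ⁆ ∪ (⁅ e₃ ⁆ ∪ (⁅ e₅ ⁆ ∪ ⁅ z ⁆)))))
lemma5p16 M connected no-detachable _ ordering maximal odd 5≤length e₁ e₂ e₃ rest refl triangle with odd⇒double odd
... | 0 , ()
... | 1 , length≡ = contradiction (subst (5 ≤_) length≡ 5≤length) λ { (s≤s (s≤s (s≤s ()))) }
... | suc (suc k) , length≡
  with odd-fan-theorem connected (≤-trans 5≤length (length≤n (proj₁ ordering))) ordering maximal no-detachable length≡ triangle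
...   | refl , z , z∉F , cocircuit with pair-view rest (suc-injective (suc-injective (suc-injective length≡)))
...     | e₄ , e₅ , refl =
  e₄ , e₅ , refl , z , z∉F , subst (IsCocircuit M) (cong (λ Z → ⁅ e₁ ⁆ ∪ (⁅ e₃ ⁆ ∪ (⁅ e₅ ⁆ ∪ Z))) (∪-identityʳ ⁅ z ⁆)) cocircuit
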